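{- For a positive integer $n$ let $[n]=\{1,\ldots,n\}$ and let $$f(n)=\max\{|S| : S\subseteq [n]^2,\ \text{for all distinct } a,b,c\in S,\ d(a,b)\neq d(b,c)\},$$ where $d$ denotes Euclidean distance in $\mathbb{R}^2$ (i.e. $f(n)$ is the maximum size of a subset of the $n\times n$ grid containing no three points forming a possibly degenerate isosceles triangle). There exists an absolute constant $c>0$ such that for all integers $n\geq 2$, $$f(n)\geq \frac{cn}{\sqrt{\log n}}.$$ -}

module Defs where

open import Data.Nat using (ℕ; _+_; _*_; ∣_-_∣)
open import Data.Fin using (Fin; toℕ)
open import Data.Product using (_×_; _,_)
open import Data.List using (List)
open import Data.List.Membership.Propositional using (_∈_)
open import Data.List.Relation.Unary.Unique.Propositional using (Unique)
open import Relation.Binary.PropositionalEquality using (_≡_; _≢_)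

-- A point of the n × n grid [n]^2.  Coordinates are stored as Fin n,
-- i.e. shifted by −1 (0..n−1 instead of 1..n); distances are unaffected.
Point : ℕ → Set
Point n = Fin n × Fin n

-- Squared Euclidean distance between two grid points (a natural number).
-- Since d ≥ 0, d(a,b) ≠ d(b,c)  ⇔  d(a,b)² ≠ d(b,c)².
dist² : ∀ {n} → Point n → Point n → ℕ
dist² (x₁ , y₁) (x₂ , y₂) =
  ∣ toℕ x₁ - toℕ x₂ ∣ * ∣ toℕ x₁ - toℕ x₂ ∣ + ∣ toℕ y₁ - toℕ y₂ ∣ * ∣ toℕ y₁ - toℕ y₂ ∣

IsoFree : ∀ {n} → List (Point n) → Set
IsoFree {n} S = (a b c : Point n) → a ∈ S → b ∈ S → c ∈ S →
  a ≢ b → b ≢ c → a ≢ c → dist² a b ≢ dist² b c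

-- A finite subset of [n]^2 represented as a duplicate-free list
-- (so its cardinality |S| is the length of the list).
record IsoFreeSet (n : ℕ) : Set where
  field
    elems  : List (Point n)
    unique : Unique elems
    isoFree : IsoFree elems

-- Call an ordered triple (a, b, c) of grid points equidistant if d(a, b) = d(b, c). Fixing b, the
-- maps i ↦ ∣ i - b ∣ are at most two-to-one, so there are at most 16 n² Q(n) equidistant triples,
-- where Q(n) = equalNorms n counts the solutions of X² + Y² = Z² + W² in [0, n)⁴. Off the diagonal
-- such a solution satisfies (X − Z)(X + Z) = (W − Y)(W + Y), so Q(n) is at most n² plus twice the
-- multiplicative energy of an interval of length 3n, which a divisor-sum argument bounds by
-- O(n² log n). Hence there are O(n⁴ log n) equidistant triples. Deleting, one at a time, a point
-- lying in the most triples keeps (number of triples)/(k(k − 1)(k − 2)) from increasing as the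
-- number k of points drops, so for k ≈ c n / √(log n) fewer than k/2 triples survive; deleting one
-- point of each of them leaves an isosceles-free set of at least k/2 points.

module Submission where

open import Defs
open import Level using (Level)
open import Data.Bool using (Bool; true; false; T; _∧_; not)
open import Data.Bool.Properties using (∧-zeroʳ; ∧-identityʳ)
open import Data.Fin as Fin using (Fin; toℕ)
open import Data.List using (List; []; _∷_; _++_; map; cartesianProduct; tabulate; allFin; filter; length)
open import Data.List.Extrema.Nat using (argmax; argmax-all; f[⊥]≤f[argmax]; f[xs]≤f[argmax])
open import Data.List.Membership.Propositional using (_∈_)
open import Data.List.Membership.Propositional.Properties using (∈-cartesianProduct⁺; ∈-allFin; ∈-filter⁺; ∈-filter⁻)
open import Data.List.Relation.Unary.All as All using (All; [])
open import Data.List.Relation.Unary.All.Properties using (all-filter)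
open import Data.List.Relation.Unary.AllPairs using ([]; _∷_)
open import Data.List.Relation.Unary.Any using (here; there)
open import Data.List.Relation.Unary.Unique.Propositional using (Unique)
open import Data.List.Relation.Unary.Unique.Propositional.Properties using (cartesianProduct⁺; allFin⁺; filter⁺)
open import Data.Nat
open import Data.Nat.Divisibility
open import Data.Nat.GCD
open import Data.Nat.Induction using (<-wellFounded)
open import Data.Nat.Logarithm using (⌈log₂_⌉; ⌈log₂⌉-mono-≤)
open import Data.Nat.Logarithm.Core using (⌈log2⌉)
open import Data.Nat.Properties
open import Data.Nat.Tactic.RingSolver using (solve-∀)
open import Data.Product using (Σ; ∃-syntax; _×_; _,_; proj₂)
open import Data.Product.Properties using (≡-dec)
open import Data.Sum using (inj₁; inj₂)
open import Function using (_∘_; it)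
open import Induction.WellFounded using (Acc; acc)
open import Relation.Binary.Definitions using (DecidableEquality; tri<; tri≈; tri>)
open import Relation.Binary.PropositionalEquality
open import Relation.Nullary using (Dec; yes; no; ¬_; contradiction; does)
open import Relation.Nullary.Decidable using (_×-dec_; ¬?; T?)
open import Algebra.Properties.CommutativeSemigroup +-commutativeSemigroup
  using () renaming (interchange to +-interchange)

-- Indicators and finite sums

private
  variable
    ℓ ℓ′ : Level
    P Q : Set ℓ
    A B : Set ℓ

𝟙 : Dec P → ℕ
𝟙 (yes _) = 1
𝟙 (no _) = 0

𝟙-yes : (P? : Dec P) → P → 𝟙 P? ≡ 1
𝟙-yes (yes _) _ = refl
𝟙-yes (no ¬p) p = contradiction p ¬p

𝟙-no : (P? : Dec P) → ¬ P → 𝟙 P? ≡ 0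
𝟙-no (yes p) ¬p = contradiction p ¬p
𝟙-no (no _) _ = refl

𝟙-yes-* : (P? : Dec P) → P → ∀ n → 𝟙 P? * n ≡ n
𝟙-yes-* (yes _) _ n = *-identityˡ n
𝟙-yes-* (no ¬p) p _ = contradiction p ¬p

𝟙-mono : (P? : Dec P) (Q? : Dec Q) → (P → Q) → 𝟙 P? ≤ 𝟙 Q?
𝟙-mono (yes p) (yes _) _ = ≤-refl
𝟙-mono (yes p) (no ¬q) f = contradiction (f p) ¬q
𝟙-mono (no _) _ _ = z≤n

𝟙-cong : (P? : Dec P) (Q? : Dec Q) → (P → Q) → (Q → P) → 𝟙 P? ≡ 𝟙 Q?
𝟙-cong P? Q? f g = ≤-antisym (𝟙-mono P? Q? f) (𝟙-mono Q? P? g)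

𝟙-× : (P? : Dec P) (Q? : Dec Q) → 𝟙 P? * 𝟙 Q? ≡ 𝟙 (P? ×-dec Q?)
𝟙-× (yes _) (yes _) = refl
𝟙-× (yes _) (no _) = refl
𝟙-× (no _) _ = refl

∑< : ℕ → (ℕ → ℕ) → ℕ
∑< zero f = 0
∑< (suc m) f = f 0 + ∑< m (f ∘ suc)

infix 5 ∑<
syntax ∑< m (λ i → e) = ∑[ i < m ] e

∑-cong : ∀ m {f g : ℕ → ℕ} → (∀ i → i < m → f i ≡ g i) → ∑< m f ≡ ∑< m g
∑-cong zero _ = refl
∑-cong (suc m) f≡g = cong₂ _+_ (f≡g 0 z<s) (∑-cong m λ i i<m → f≡g (suc i) (s<s i<m))

∑-mono-≤ : ∀ m {f g : ℕ → ℕ} → (∀ i → i < m → f i ≤ g i) → ∑< m f ≤ ∑< m g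
∑-mono-≤ zero _ = z≤n
∑-mono-≤ (suc m) f≤g = +-mono-≤ (f≤g 0 z<s) (∑-mono-≤ m λ i i<m → f≤g (suc i) (s<s i<m))

∑-distrib-+ : ∀ m (f g : ℕ → ℕ) → (∑[ i < m ] f i + g i) ≡ ∑< m f + ∑< m g
∑-distrib-+ zero f g = refl
∑-distrib-+ (suc m) f g =
  trans (cong (f 0 + g 0 +_) (∑-distrib-+ m (f ∘ suc) (g ∘ suc))) (+-interchange (f 0) (g 0) _ _)

*-distribˡ-∑ : ∀ m c (f : ℕ → ℕ) → c * ∑< m f ≡ ∑[ i < m ] c * f i
*-distribˡ-∑ zero c f = *-zeroʳ c
*-distribˡ-∑ (suc m) c f = trans (*-distribˡ-+ c (f 0) _) (cong (c * f 0 +_) (*-distribˡ-∑ m c (f ∘ suc)))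

*-distribʳ-∑ : ∀ m c (f : ℕ → ℕ) → ∑< m f * c ≡ ∑[ i < m ] f i * c
*-distribʳ-∑ m c f = trans (*-comm _ c) (trans (*-distribˡ-∑ m c f) (∑-cong m λ i _ → *-comm c (f i)))

∑-const : ∀ m c → ∑[ i < m ] c ≡ m * c
∑-const zero c = refl
∑-const (suc m) c = cong (c +_) (∑-const m c)

∑-zero : ∀ m {f : ℕ → ℕ} → (∀ i → i < m → f i ≡ 0) → ∑< m f ≡ 0
∑-zero m f≡0 = trans (∑-cong m f≡0) (trans (∑-const m 0) (*-zeroʳ m))

∑-comm : ∀ a b (f : ℕ → ℕ → ℕ) → ∑[ i < a ] ∑[ j < b ] f i j ≡ ∑[ j < b ] ∑[ i < a ] f i j
∑-comm zero b f = sym (∑-zero b λ _ _ → refl)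
∑-comm (suc a) b f = begin
  (∑[ j < b ] f 0 j) + (∑[ i < a ] ∑[ j < b ] f (suc i) j) ≡⟨ cong ((∑[ j < b ] f 0 j) +_) (∑-comm a b (f ∘ suc)) ⟩
  (∑[ j < b ] f 0 j) + (∑[ j < b ] ∑[ i < a ] f (suc i) j) ≡⟨ ∑-distrib-+ b (f 0) (λ j → ∑[ i < a ] f (suc i) j) ⟨
  (∑[ j < b ] f 0 j + (∑[ i < a ] f (suc i) j))        ∎
  where open ≡-Reasoning

∑-split : ∀ a b (f : ℕ → ℕ) → ∑< (a + b) f ≡ ∑< a f + (∑[ i < b ] f (a + i))
∑-split zero b f = refl
∑-split (suc a) b f = trans (cong (f 0 +_) (∑-split a b (f ∘ suc))) (sym (+-assoc (f 0) _ _))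

∑-mono-range : ∀ {m m′} (f : ℕ → ℕ) → m ≤ m′ → ∑< m f ≤ ∑< m′ f
∑-mono-range {m} {m′} f m≤m′ = begin
  ∑< m f                                   ≤⟨ m≤m+n _ _ ⟩
  ∑< m f + (∑[ i < m′ ∸ m ] f (m + i))     ≡⟨ ∑-split m (m′ ∸ m) f ⟨
  ∑< (m + (m′ ∸ m)) f                      ≡⟨ cong (λ k → ∑< k f) (m+[n∸m]≡n m≤m′) ⟩
  ∑< m′ f                                  ∎
  where open ≤-Reasoning

term≤∑ : ∀ m (f : ℕ → ℕ) {i} → i < m → f i ≤ ∑< m f
term≤∑ (suc m) f {zero} _ = m≤m+n _ _
term≤∑ (suc m) f {suc i} (s<s i<m) = ≤-trans (term≤∑ m (f ∘ suc) i<m) (m≤n+m _ _)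

∑-𝟙-≟ : ∀ m (f : ℕ → ℕ) {j} → j < m → ∑[ i < m ] 𝟙 (i ≟ j) * f i ≡ f j
∑-𝟙-≟ (suc m) f {zero} _ =
  trans (cong₂ _+_ (+-identityʳ (f 0)) (∑-zero m λ _ _ → refl)) (+-identityʳ _)
∑-𝟙-≟ (suc m) f {suc j} (s<s j<m) = trans
  (∑-cong m λ i _ → cong (_* f (suc i)) (𝟙-cong (suc i ≟ suc j) (i ≟ j) suc-injective (cong suc)))
  (∑-𝟙-≟ m (f ∘ suc) j<m)

∑-𝟙-unique≤1 : ∀ m {P : ℕ → Set ℓ} (P? : ∀ i → Dec (P i)) →
  (∀ {i j} → i < m → j < m → P i → P j → i ≡ j) → ∑[ i < m ] 𝟙 (P? i) ≤ 1
∑-𝟙-unique≤1 zero P? _ = z≤n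
∑-𝟙-unique≤1 (suc m) P? unique with P? 0
... | yes p0 = ≤-reflexive (cong suc (∑-zero m λ i i<m →
  𝟙-no (P? (suc i)) λ pi → 0≢1+n (unique z<s (s<s i<m) p0 pi)))
... | no _ = ∑-𝟙-unique≤1 m (P? ∘ suc) λ i<m j<m pi pj →
  suc-injective (unique (s<s i<m) (s<s j<m) pi pj)

∑-𝟙-unique≤𝟙 : ∀ m {P : ℕ → Set ℓ} (P? : ∀ i → Dec (P i)) (Q? : Dec Q) → (∀ {i} → P i → Q) →
  (∀ {i j} → i < m → j < m → P i → P j → i ≡ j) → ∑[ i < m ] 𝟙 (P? i) ≤ 𝟙 Q?
∑-𝟙-unique≤𝟙 m P? (yes _) _ unique = ∑-𝟙-unique≤1 m P? unique
∑-𝟙-unique≤𝟙 m P? (no ¬q) P⇒Q _ = ≤-reflexive (∑-zero m λ i _ → 𝟙-no (P? i) (¬q ∘ P⇒Q))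

∑-reindex-≤ : ∀ m m′ {P : ℕ → Set ℓ} (P? : ∀ i → Dec (P i)) (φ h : ℕ → ℕ) →
  (∀ {i} → i < m → P i → φ i < m′) →
  (∀ {i j} → i < m → j < m → P i → P j → φ i ≡ φ j → i ≡ j) →
  ∑[ i < m ] 𝟙 (P? i) * h (φ i) ≤ ∑< m′ h
∑-reindex-≤ m m′ P? φ h φ<m′ φ-injective = begin
  ∑[ i < m ] 𝟙 (P? i) * h (φ i)                          ≡⟨ ∑-cong m expand ⟩
  ∑[ i < m ] ∑[ j < m′ ] 𝟙 (P? i) * (𝟙 (j ≟ φ i) * h j) ≡⟨ ∑-comm m m′ _ ⟩
  ∑[ j < m′ ] ∑[ i < m ] 𝟙 (P? i) * (𝟙 (j ≟ φ i) * h j) ≡⟨ ∑-cong m′ (λ j _ → collect j) ⟩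
  ∑[ j < m′ ] (∑[ i < m ] 𝟙 (P? i ×-dec j ≟ φ i)) * h j  ≤⟨ ∑-mono-≤ m′ (λ j _ → *-monoˡ-≤ (h j) (fibre≤1 j)) ⟩
  ∑[ j < m′ ] 1 * h j                                    ≡⟨ ∑-cong m′ (λ j _ → *-identityˡ (h j)) ⟩
  ∑< m′ h                                                ∎
  where
  open ≤-Reasoning
  expand : ∀ i → i < m → 𝟙 (P? i) * h (φ i) ≡ ∑[ j < m′ ] 𝟙 (P? i) * (𝟙 (j ≟ φ i) * h j)
  expand i i<m with P? i
  ... | yes p = trans (cong (1 *_) (sym (∑-𝟙-≟ m′ h (φ<m′ i<m p)))) (*-distribˡ-∑ m′ 1 _)
  ... | no _ = sym (∑-zero m′ λ _ _ → refl)
  collect : ∀ j → ∑[ i < m ] 𝟙 (P? i) * (𝟙 (j ≟ φ i) * h j) ≡ (∑[ i < m ] 𝟙 (P? i ×-dec j ≟ φ i)) * h j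
  collect j = trans (∑-cong m λ i _ → trans (sym (*-assoc (𝟙 (P? i)) _ _)) (cong (_* h j) (𝟙-× (P? i) (j ≟ φ i))))
                    (sym (*-distribʳ-∑ m (h j) _))
  fibre≤1 : ∀ j → ∑[ i < m ] 𝟙 (P? i ×-dec j ≟ φ i) ≤ 1
  fibre≤1 j = ∑-𝟙-unique≤1 m (λ i → P? i ×-dec j ≟ φ i)
    λ i<m i′<m (pi , j≡φi) (pi′ , j≡φi′) → φ-injective i<m i′<m pi pi′ (trans (sym j≡φi) j≡φi′)

∑-𝟙≤-truncate : ∀ M c (f : ℕ → ℕ) → c < M → ∑[ a < M ] 𝟙 (a ≤? c) * f a ≡ ∑< (suc c) f
∑-𝟙≤-truncate M c f c<M = begin
  ∑[ a < M ] 𝟙 (a ≤? c) * f a                      ≡⟨ cong (λ k → ∑[ a < k ] 𝟙 (a ≤? c) * f a) (sym M≡1+c+r) ⟩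
  ∑[ a < suc c + r ] 𝟙 (a ≤? c) * f a              ≡⟨ ∑-split (suc c) r (λ a → 𝟙 (a ≤? c) * f a) ⟩
  (∑[ a < suc c ] 𝟙 (a ≤? c) * f a) + (∑[ i < r ] 𝟙 (suc c + i ≤? c) * f (suc c + i))
    ≡⟨ cong₂ _+_ (∑-cong (suc c) λ a a≤c → 𝟙-yes-* (a ≤? c) (≤-pred a≤c) (f a))
                 (∑-zero r λ i _ → cong (_* f (suc c + i)) (𝟙-no (suc c + i ≤? c) (<⇒≱ (m≤m+n (suc c) i)))) ⟩
  ∑< (suc c) f + 0                                ≡⟨ +-identityʳ _ ⟩
  ∑< (suc c) f                                    ∎
  where
  open ≡-Reasoning
  r = M ∸ suc c
  M≡1+c+r : suc c + r ≡ M
  M≡1+c+r = m+[n∸m]≡n c<M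

∑⁴ : ℕ → (ℕ → ℕ → ℕ → ℕ → ℕ) → ℕ
∑⁴ M F = ∑[ a < M ] ∑[ b < M ] ∑[ c < M ] ∑[ d < M ] F a b c d

∑⁴-mono-≤ : ∀ M {F G : ℕ → ℕ → ℕ → ℕ → ℕ} → (∀ a b c d → F a b c d ≤ G a b c d) → ∑⁴ M F ≤ ∑⁴ M G
∑⁴-mono-≤ M F≤G =
  ∑-mono-≤ M λ a _ → ∑-mono-≤ M λ b _ → ∑-mono-≤ M λ c _ → ∑-mono-≤ M λ d _ → F≤G a b c d

∑⁴-distrib-+ : ∀ M (F G : ℕ → ℕ → ℕ → ℕ → ℕ) → ∑⁴ M (λ a b c d → F a b c d + G a b c d) ≡ ∑⁴ M F + ∑⁴ M G
∑⁴-distrib-+ M F G =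
  trans (∑-cong M λ a _ →
          trans (∑-cong M λ b _ →
                  trans (∑-cong M λ c _ → ∑-distrib-+ M (F a b c) (G a b c))
                        (∑-distrib-+ M (λ c → ∑< M (F a b c)) (λ c → ∑< M (G a b c))))
                (∑-distrib-+ M (λ b → ∑[ c < M ] ∑< M (F a b c)) (λ b → ∑[ c < M ] ∑< M (G a b c))))
        (∑-distrib-+ M (λ a → ∑[ b < M ] ∑[ c < M ] ∑< M (F a b c)) (λ a → ∑[ b < M ] ∑[ c < M ] ∑< M (G a b c)))

∑⁴-swap-pairs : ∀ M (F : ℕ → ℕ → ℕ → ℕ → ℕ) → ∑⁴ M (λ a b c d → F c d a b) ≡ ∑⁴ M F
∑⁴-swap-pairs M F = begin
  ∑[ a < M ] ∑[ b < M ] ∑[ c < M ] ∑[ d < M ] F c d a b ≡⟨ ∑-cong M (λ a _ → ∑-comm M M _) ⟩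
  ∑[ a < M ] ∑[ c < M ] ∑[ b < M ] ∑[ d < M ] F c d a b ≡⟨ ∑-comm M M _ ⟩
  ∑[ c < M ] ∑[ a < M ] ∑[ b < M ] ∑[ d < M ] F c d a b ≡⟨ ∑-cong M (λ c _ → ∑-cong M λ a _ → ∑-comm M M _) ⟩
  ∑[ c < M ] ∑[ a < M ] ∑[ d < M ] ∑[ b < M ] F c d a b ≡⟨ ∑-cong M (λ c _ → ∑-comm M M _) ⟩
  ∑[ c < M ] ∑[ d < M ] ∑[ a < M ] ∑[ b < M ] F c d a b ∎
  where open ≡-Reasoning

∑-injective-≤ : ∀ m m′ (φ h : ℕ → ℕ) → (∀ {i} → i < m → φ i < m′) →
  (∀ {i j} → i < m → j < m → φ i ≡ φ j → i ≡ j) → ∑[ i < m ] h (φ i) ≤ ∑< m′ h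
∑-injective-≤ m m′ φ h φ<m′ φ-injective = begin
  ∑[ i < m ] h (φ i)               ≡⟨ ∑-cong m (λ i i<m → sym (𝟙-yes-* (i <? m) i<m (h (φ i)))) ⟩
  ∑[ i < m ] 𝟙 (i <? m) * h (φ i)  ≤⟨ ∑-reindex-≤ m m′ (_<? m) φ h (λ i<m _ → φ<m′ i<m) (λ i<m j<m _ _ → φ-injective i<m j<m) ⟩
  ∑< m′ h                          ∎
  where open ≤-Reasoning

∑∈ : List A → (A → ℕ) → ℕ
∑∈ [] f = 0
∑∈ (x ∷ xs) f = f x + ∑∈ xs f

infix 5 ∑∈
syntax ∑∈ xs (λ x → e) = ∑[ x ∈ xs ] e

∑∈-cong : ∀ (xs : List A) {f g : A → ℕ} → (∀ x → f x ≡ g x) → ∑∈ xs f ≡ ∑∈ xs g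
∑∈-cong [] _ = refl
∑∈-cong (x ∷ xs) f≡g = cong₂ _+_ (f≡g x) (∑∈-cong xs f≡g)

∑∈-mono-≤ : ∀ (xs : List A) {f g : A → ℕ} → (∀ x → f x ≤ g x) → ∑∈ xs f ≤ ∑∈ xs g
∑∈-mono-≤ [] _ = z≤n
∑∈-mono-≤ (x ∷ xs) f≤g = +-mono-≤ (f≤g x) (∑∈-mono-≤ xs f≤g)

∑∈-distrib-+ : ∀ (xs : List A) (f g : A → ℕ) → (∑[ x ∈ xs ] f x + g x) ≡ ∑∈ xs f + ∑∈ xs g
∑∈-distrib-+ [] f g = refl
∑∈-distrib-+ (x ∷ xs) f g = trans (cong (f x + g x +_) (∑∈-distrib-+ xs f g)) (+-interchange (f x) (g x) _ _)

*-distribˡ-∑∈ : ∀ (xs : List A) c (f : A → ℕ) → c * ∑∈ xs f ≡ ∑[ x ∈ xs ] c * f x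
*-distribˡ-∑∈ [] c f = *-zeroʳ c
*-distribˡ-∑∈ (x ∷ xs) c f = trans (*-distribˡ-+ c (f x) _) (cong (c * f x +_) (*-distribˡ-∑∈ xs c f))

*-distribʳ-∑∈ : ∀ (xs : List A) c (f : A → ℕ) → ∑∈ xs f * c ≡ ∑[ x ∈ xs ] f x * c
*-distribʳ-∑∈ xs c f = trans (*-comm _ c) (trans (*-distribˡ-∑∈ xs c f) (∑∈-cong xs λ x → *-comm c (f x)))

∑∈-zero : ∀ (xs : List A) {f : A → ℕ} → (∀ {x} → x ∈ xs → f x ≡ 0) → ∑∈ xs f ≡ 0
∑∈-zero [] _ = refl
∑∈-zero (x ∷ xs) f≡0 = cong₂ _+_ (f≡0 (here refl)) (∑∈-zero xs (f≡0 ∘ there))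

∑∈-comm : ∀ (xs : List A) (ys : List B) (f : A → B → ℕ) →
  ∑[ x ∈ xs ] ∑[ y ∈ ys ] f x y ≡ ∑[ y ∈ ys ] ∑[ x ∈ xs ] f x y
∑∈-comm [] ys f = sym (∑∈-zero ys λ _ → refl)
∑∈-comm (x ∷ xs) ys f = trans (cong ((∑[ y ∈ ys ] f x y) +_) (∑∈-comm xs ys f))
                              (sym (∑∈-distrib-+ ys (f x) λ y → ∑[ x′ ∈ xs ] f x′ y))

term≤∑∈ : ∀ (xs : List A) (f : A → ℕ) {x} → x ∈ xs → f x ≤ ∑∈ xs f
term≤∑∈ (y ∷ xs) f (here refl) = m≤m+n _ _
term≤∑∈ (y ∷ xs) f (there x∈xs) = ≤-trans (term≤∑∈ xs f x∈xs) (m≤n+m _ _)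

∑∈-++ : ∀ (xs ys : List A) (f : A → ℕ) → ∑∈ (xs ++ ys) f ≡ ∑∈ xs f + ∑∈ ys f
∑∈-++ [] ys f = refl
∑∈-++ (x ∷ xs) ys f = trans (cong (f x +_) (∑∈-++ xs ys f)) (sym (+-assoc (f x) _ _))

∑∈-map : ∀ (g : A → B) (xs : List A) (f : B → ℕ) → ∑∈ (map g xs) f ≡ ∑[ x ∈ xs ] f (g x)
∑∈-map g [] f = refl
∑∈-map g (x ∷ xs) f = cong (f (g x) +_) (∑∈-map g xs f)

∑∈-cartesianProduct : ∀ (xs : List A) (ys : List B) (f : A × B → ℕ) →
  ∑∈ (cartesianProduct xs ys) f ≡ ∑[ x ∈ xs ] ∑[ y ∈ ys ] f (x , y)
∑∈-cartesianProduct [] ys f = refl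
∑∈-cartesianProduct (x ∷ xs) ys f = trans (∑∈-++ (map (x ,_) ys) (cartesianProduct xs ys) f)
  (cong₂ _+_ (∑∈-map (x ,_) ys f) (∑∈-cartesianProduct xs ys f))

∑∈-tabulate : ∀ n (g : Fin n → A) (f : A → ℕ) (F : ℕ → ℕ) → (∀ i → f (g i) ≡ F (toℕ i)) →
  ∑∈ (tabulate g) f ≡ ∑< n F
∑∈-tabulate zero g f F _ = refl
∑∈-tabulate (suc n) g f F f∘g≡F = cong₂ _+_ (f∘g≡F Fin.zero) (∑∈-tabulate n (g ∘ Fin.suc) f (F ∘ suc) (f∘g≡F ∘ Fin.suc))

∑∈-𝟙-≟ : (_≟ᴬ_ : DecidableEquality A) → ∀ {xs} → Unique xs → ∀ {x} → x ∈ xs → (f : A → ℕ) →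
  ∑[ a ∈ xs ] f a * 𝟙 (a ≟ᴬ x) ≡ f x
∑∈-𝟙-≟ _≟ᴬ_ {y ∷ xs} (y∉xs ∷ xs-unique) {x} x∈ f with y ≟ᴬ x | x∈
... | yes refl | _ = trans (cong₂ _+_ (*-identityʳ (f y)) others-vanish) (+-identityʳ _)
  where
  others-vanish : ∑[ a ∈ xs ] f a * 𝟙 (a ≟ᴬ y) ≡ 0
  others-vanish = ∑∈-zero xs λ {a} a∈xs →
    trans (cong (f a *_) (𝟙-no (a ≟ᴬ y) λ a≡y → All.lookup y∉xs a∈xs (sym a≡y))) (*-zeroʳ (f a))
... | no y≢x | here y≡x = contradiction (sym y≡x) y≢x
... | no _ | there x∈xs = trans (cong (_+ (∑[ a ∈ xs ] f a * 𝟙 (a ≟ᴬ x))) (*-zeroʳ (f y))) (∑∈-𝟙-≟ _≟ᴬ_ xs-unique x∈xs f)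

length-filter : ∀ {P : A → Set ℓ′} (P? : ∀ x → Dec (P x)) (xs : List A) → length (filter P? xs) ≡ ∑[ x ∈ xs ] 𝟙 (P? x)
length-filter P? [] = refl
length-filter P? (x ∷ xs) with P? x
... | yes _ = cong suc (length-filter P? xs)
... | no _ = length-filter P? xs

-- Multiplicative energy

multiples≤ : ∀ e .{{_ : NonZero e}} K → e * (∑[ i < K ] 𝟙 (e ∣? suc i)) ≤ K
multiples≤ e K = go K (<-wellFounded K)
  where
  open ≤-Reasoning
  go : ∀ K → Acc _<_ K → e * (∑[ i < K ] 𝟙 (e ∣? suc i)) ≤ K
  go K (acc rec) with K <? e
  ... | yes K<e = ≤-trans (≤-reflexive (trans (cong (e *_) none) (*-zeroʳ e))) z≤n
    where
    none : ∑[ i < K ] 𝟙 (e ∣? suc i) ≡ 0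
    none = ∑-zero K λ i i<K → 𝟙-no (e ∣? suc i) λ e∣1+i → <⇒≱ (≤-<-trans i<K K<e) (∣⇒≤ e∣1+i)
  ... | no K≮e = begin
    e * ∑< K g                                    ≡⟨ cong (λ k → e * ∑< k g) (sym e+r≡K) ⟩
    e * ∑< (e + r) g                              ≡⟨ cong (e *_) (∑-split e r g) ⟩
    e * (∑< e g + (∑[ i < r ] g (e + i)))         ≤⟨ *-monoʳ-≤ e (+-mono-≤ first-block (≤-reflexive (∑-cong r λ i _ → shift i))) ⟩
    e * (1 + ∑< r g)                              ≡⟨ *-distribˡ-+ e 1 _ ⟩
    e * 1 + e * ∑< r g                            ≤⟨ +-mono-≤ (≤-reflexive (*-identityʳ e)) (go r (rec r<K)) ⟩
    e + r                                         ≡⟨ e+r≡K ⟩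
    K                                             ∎
    where
    g : ℕ → ℕ
    g i = 𝟙 (e ∣? suc i)
    r = K ∸ e
    e+r≡K : e + r ≡ K
    e+r≡K = m+[n∸m]≡n (≮⇒≥ K≮e)
    r<K : r < K
    r<K = ∸-monoʳ-< (>-nonZero⁻¹ e) (≮⇒≥ K≮e)
    first-block : ∑< e g ≤ 1
    first-block = ∑-𝟙-unique≤1 e (λ i → e ∣? suc i) λ i<e j<e e∣1+i e∣1+j →
      suc-injective (trans (≤-antisym i<e (∣⇒≤ e∣1+i)) (≤-antisym (∣⇒≤ e∣1+j) j<e))
    shift : ∀ i → g (e + i) ≡ g i
    shift i = 𝟙-cong (e ∣? suc (e + i)) (e ∣? suc i)
      (λ e∣ → ∣m+n∣m⇒∣n (subst (e ∣_) (sym (+-suc e i)) e∣) ∣-refl)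
      (λ e∣ → subst (e ∣_) (+-suc e i) (∣m∣n⇒∣m+n ∣-refl e∣))

∣*⇒∣gcd* : ∀ {α β γ} → γ ∣ α * β → γ ∣ gcd α γ * β
∣*⇒∣gcd* {α} {β} {γ} γ∣αβ = subst (γ ∣_) gcd[βα,βγ]≡gcd[α,γ]β
  (gcd-greatest (subst (γ ∣_) (*-comm α β) γ∣αβ) (n∣m*n β))
  where
  gcd[βα,βγ]≡gcd[α,γ]β : gcd (β * α) (β * γ) ≡ gcd α γ * β
  gcd[βα,βγ]≡gcd[α,γ]β = trans (sym (c*gcd[m,n]≡gcd[cm,cn] β α γ)) (*-comm β _)

∑-∣*≤ : ∀ M α γ .{{_ : NonZero γ}} → γ * (∑[ b < M ] 𝟙 (γ ∣? α * suc b)) ≤ gcd α γ * M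
∑-∣*≤ M α γ with gcd[m,n]∣n α γ
... | divides γ′ γ≡γ′g = begin
  γ * (∑[ b < M ] 𝟙 (γ ∣? α * suc b))       ≤⟨ *-monoʳ-≤ γ (∑-mono-≤ M λ b _ → 𝟙-mono (γ ∣? α * suc b) (γ′ ∣? suc b) γ′∣) ⟩
  γ * c                                      ≡⟨ cong (_* c) γ≡gγ′ ⟩
  g * γ′ * c                                 ≡⟨ *-assoc g γ′ c ⟩
  g * (γ′ * c)                               ≤⟨ *-monoʳ-≤ g (multiples≤ γ′ M) ⟩
  g * M                                      ∎
  where
  open ≤-Reasoning
  g = gcd α γ
  c = ∑[ b < M ] 𝟙 (γ′ ∣? suc b)
  γ≡gγ′ : γ ≡ g * γ′
  γ≡gγ′ = trans γ≡γ′g (*-comm γ′ g)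
  instance
    g≢0 : NonZero g
    g≢0 = ≢-nonZero (gcd[m,n]≢0 α γ (inj₂ (≢-nonZero⁻¹ γ)))
    γ′≢0 : NonZero γ′
    γ′≢0 = m*n≢0⇒m≢0 γ′ {{subst NonZero γ≡γ′g it}}
  γ′∣ : ∀ {b} → γ ∣ α * suc b → γ′ ∣ suc b
  γ′∣ {b} γ∣ = *-cancelˡ-∣ g (subst (_∣ g * suc b) γ≡gγ′ (∣*⇒∣gcd* {α} {suc b} γ∣))

τ : ℕ → ℕ → ℕ
τ M γ = ∑[ e < M ] 𝟙 (suc e ∣? γ)

common-divisor≤∑ : ∀ M {x y d} .{{_ : NonZero d}} → d ∣ x → d ∣ y → d ≤ M →
  d ≤ ∑[ e < M ] 𝟙 (suc e ∣? x) * (𝟙 (suc e ∣? y) * suc e)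
common-divisor≤∑ M {x} {y} {suc d′} d∣x d∣y d≤M = ≤-trans (≤-reflexive (sym term≡d)) (term≤∑ M _ d≤M)
  where
  term≡d : 𝟙 (suc d′ ∣? x) * (𝟙 (suc d′ ∣? y) * suc d′) ≡ suc d′
  term≡d = trans (cong₂ (λ u v → u * (v * suc d′)) (𝟙-yes (suc d′ ∣? x) d∣x) (𝟙-yes (suc d′ ∣? y) d∣y))
                 (trans (*-identityˡ _) (*-identityˡ _))

∑-gcd≤ : ∀ M γ .{{_ : NonZero γ}} → γ ≤ M → ∑[ a < γ ] gcd (suc a) γ ≤ γ * τ M γ
∑-gcd≤ M γ γ≤M = begin
  ∑[ a < γ ] gcd (suc a) γ                                           ≤⟨ ∑-mono-≤ γ (λ a _ → gcd≤ a) ⟩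
  ∑[ a < γ ] ∑[ e < M ] 𝟙 (suc e ∣? γ) * (𝟙 (suc e ∣? suc a) * suc e) ≡⟨ ∑-comm γ M _ ⟩
  ∑[ e < M ] ∑[ a < γ ] 𝟙 (suc e ∣? γ) * (𝟙 (suc e ∣? suc a) * suc e) ≡⟨ ∑-cong M (λ e _ → regroup e) ⟩
  ∑[ e < M ] 𝟙 (suc e ∣? γ) * (suc e * (∑[ a < γ ] 𝟙 (suc e ∣? suc a))) ≤⟨ ∑-mono-≤ M (λ e _ → *-monoʳ-≤ (𝟙 (suc e ∣? γ)) (multiples≤ (suc e) γ)) ⟩
  ∑[ e < M ] 𝟙 (suc e ∣? γ) * γ                                      ≡⟨ *-distribʳ-∑ M γ (λ e → 𝟙 (suc e ∣? γ)) ⟨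
  τ M γ * γ                                                          ≡⟨ *-comm (τ M γ) γ ⟩
  γ * τ M γ                                                          ∎
  where
  open ≤-Reasoning
  gcd≤ : ∀ a → gcd (suc a) γ ≤ ∑[ e < M ] 𝟙 (suc e ∣? γ) * (𝟙 (suc e ∣? suc a) * suc e)
  gcd≤ a = common-divisor≤∑ M {{≢-nonZero (gcd[m,n]≢0 (suc a) γ (inj₁ λ ()))}}
    (gcd[m,n]∣n (suc a) γ) (gcd[m,n]∣m (suc a) γ) (≤-trans (gcd[m,n]≤n (suc a) γ) γ≤M)
  regroup : ∀ e → ∑[ a < γ ] 𝟙 (suc e ∣? γ) * (𝟙 (suc e ∣? suc a) * suc e)
                ≡ 𝟙 (suc e ∣? γ) * (suc e * (∑[ a < γ ] 𝟙 (suc e ∣? suc a)))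
  regroup e = begin-equality
    ∑[ a < γ ] 𝟙 (suc e ∣? γ) * (𝟙 (suc e ∣? suc a) * suc e) ≡⟨ *-distribˡ-∑ γ (𝟙 (suc e ∣? γ)) (λ a → 𝟙 (suc e ∣? suc a) * suc e) ⟨
    𝟙 (suc e ∣? γ) * (∑[ a < γ ] 𝟙 (suc e ∣? suc a) * suc e) ≡⟨ cong (𝟙 (suc e ∣? γ) *_) (*-distribʳ-∑ γ (suc e) (λ a → 𝟙 (suc e ∣? suc a))) ⟨
    𝟙 (suc e ∣? γ) * ((∑[ a < γ ] 𝟙 (suc e ∣? suc a)) * suc e) ≡⟨ cong (𝟙 (suc e ∣? γ) *_) (*-comm _ (suc e)) ⟩
    𝟙 (suc e ∣? γ) * (suc e * (∑[ a < γ ] 𝟙 (suc e ∣? suc a))) ∎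

harmonic≤ : ∀ K M (a : ℕ → ℕ) → (∀ e → suc e * a e ≤ M) → ∑[ e < 2 ^ K ] a e ≤ suc K * M
harmonic≤ zero M a bound = ≤-trans (bound 0) (≤-reflexive (sym (+-identityʳ M)))
harmonic≤ (suc K) M a bound = begin
  ∑< (2ᴷ + (2ᴷ + 0)) a                ≡⟨ cong (λ k → ∑< (2ᴷ + k) a) (+-identityʳ 2ᴷ) ⟩
  ∑< (2ᴷ + 2ᴷ) a                      ≡⟨ ∑-split 2ᴷ 2ᴷ a ⟩
  ∑< 2ᴷ a + (∑[ i < 2ᴷ ] a (2ᴷ + i))  ≤⟨ +-mono-≤ (harmonic≤ K M a bound) dyadic-block ⟩
  suc K * M + M                       ≡⟨ +-comm (suc K * M) M ⟩
  suc (suc K) * M                     ∎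
  where
  open ≤-Reasoning
  2ᴷ = 2 ^ K
  instance
    2^K≢0 : NonZero 2ᴷ
    2^K≢0 = m^n≢0 2 K
  dyadic-block : ∑[ i < 2ᴷ ] a (2ᴷ + i) ≤ M
  dyadic-block = *-cancelˡ-≤ 2ᴷ (begin
    2ᴷ * (∑[ i < 2ᴷ ] a (2ᴷ + i))  ≡⟨ *-distribˡ-∑ 2ᴷ 2ᴷ (λ i → a (2ᴷ + i)) ⟩
    ∑[ i < 2ᴷ ] 2ᴷ * a (2ᴷ + i)    ≤⟨ ∑-mono-≤ 2ᴷ (λ i _ → ≤-trans (*-monoˡ-≤ (a (2ᴷ + i)) (m≤n⇒m≤1+n (m≤m+n 2ᴷ i))) (bound (2ᴷ + i))) ⟩
    ∑[ i < 2ᴷ ] M                  ≡⟨ ∑-const 2ᴷ M ⟩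
    2ᴷ * M                         ∎)

divisor-sum≤ : ∀ M K → M ≤ 2 ^ K → ∑[ c < M ] τ M (suc c) ≤ suc K * M
divisor-sum≤ M K M≤2^K = begin
  ∑[ c < M ] ∑[ e < M ] 𝟙 (suc e ∣? suc c)  ≡⟨ ∑-comm M M _ ⟩
  ∑[ e < M ] ∑[ c < M ] 𝟙 (suc e ∣? suc c)  ≤⟨ ∑-mono-range _ M≤2^K ⟩
  ∑[ e < 2 ^ K ] ∑[ c < M ] 𝟙 (suc e ∣? suc c) ≤⟨ harmonic≤ K M _ (λ e → multiples≤ (suc e) M) ⟩
  suc K * M                                 ∎
  where open ≤-Reasoning

∑∑-∣*≤ : ∀ M c → c < M → ∑[ a < suc c ] ∑[ b < M ] 𝟙 (suc c ∣? suc a * suc b) ≤ M * τ M (suc c)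
∑∑-∣*≤ M c c<M = *-cancelˡ-≤ γ (begin
  γ * (∑[ a < γ ] S a)            ≡⟨ *-distribˡ-∑ γ γ S ⟩
  ∑[ a < γ ] γ * S a              ≤⟨ ∑-mono-≤ γ (λ a _ → ∑-∣*≤ M (suc a) γ) ⟩
  ∑[ a < γ ] gcd (suc a) γ * M    ≡⟨ *-distribʳ-∑ γ M (λ a → gcd (suc a) γ) ⟨
  (∑[ a < γ ] gcd (suc a) γ) * M  ≤⟨ *-monoˡ-≤ M (∑-gcd≤ M γ c<M) ⟩
  γ * τ M γ * M                   ≡⟨ *-assoc γ (τ M γ) M ⟩
  γ * (τ M γ * M)                 ≡⟨ cong (γ *_) (*-comm (τ M γ) M) ⟩
  γ * (M * τ M γ)                 ∎)
  where
  open ≤-Reasoning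
  γ = suc c
  S : ℕ → ℕ
  S a = ∑[ b < M ] 𝟙 (γ ∣? suc a * suc b)

-- Indices are shifted by one: this counts αβ = γδ with α, β, γ, δ ∈ {1, …, M}.
energy : ℕ → ℕ
energy M = ∑⁴ M λ a b c d → 𝟙 (suc a * suc b ≟ suc c * suc d)

∑-same-product≤ : ∀ M α β γ .{{_ : NonZero γ}} → ∑[ d < M ] 𝟙 (α * β ≟ γ * suc d) ≤ 𝟙 (γ ∣? α * β)
∑-same-product≤ M α β γ = ∑-𝟙-unique≤𝟙 M (λ d → α * β ≟ γ * suc d) (γ ∣? α * β)
  (λ {d} αβ≡γ[1+d] → divides (suc d) (trans αβ≡γ[1+d] (*-comm γ (suc d))))
  (λ {d} {d′} _ _ αβ≡γ[1+d] αβ≡γ[1+d′] → suc-injective (*-cancelˡ-≡ (suc d) (suc d′) γ (trans (sym αβ≡γ[1+d]) αβ≡γ[1+d′])))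

ordered-energy≤ : ∀ M K → M ≤ 2 ^ K →
  ∑⁴ M (λ a b c d → 𝟙 (a ≤? c) * 𝟙 (suc a * suc b ≟ suc c * suc d)) ≤ M * (suc K * M)
ordered-energy≤ M K M≤2^K = begin
  ∑[ a < M ] ∑[ b < M ] ∑[ c < M ] ∑[ d < M ] H a b c d ≡⟨ ∑-cong M (λ a _ → ∑-comm M M _) ⟩
  ∑[ a < M ] ∑[ c < M ] ∑[ b < M ] ∑[ d < M ] H a b c d ≡⟨ ∑-comm M M _ ⟩
  ∑[ c < M ] ∑[ a < M ] ∑[ b < M ] ∑[ d < M ] H a b c d ≤⟨ ∑-mono-≤ M fixed-γ ⟩
  ∑[ c < M ] M * τ M (suc c)                            ≡⟨ *-distribˡ-∑ M M _ ⟨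
  M * (∑[ c < M ] τ M (suc c))                          ≤⟨ *-monoʳ-≤ M (divisor-sum≤ M K M≤2^K) ⟩
  M * (suc K * M)                                       ∎
  where
  open ≤-Reasoning
  H : ℕ → ℕ → ℕ → ℕ → ℕ
  H a b c d = 𝟙 (a ≤? c) * 𝟙 (suc a * suc b ≟ suc c * suc d)
  fixed-γ : ∀ c → c < M → ∑[ a < M ] ∑[ b < M ] ∑[ d < M ] H a b c d ≤ M * τ M (suc c)
  fixed-γ c c<M = begin
    ∑[ a < M ] ∑[ b < M ] ∑[ d < M ] H a b c d
      ≡⟨ ∑-cong M (λ a _ → pull-out a) ⟩
    ∑[ a < M ] 𝟙 (a ≤? c) * (∑[ b < M ] ∑[ d < M ] 𝟙 (suc a * suc b ≟ suc c * suc d))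
      ≤⟨ ∑-mono-≤ M (λ a _ → *-monoʳ-≤ (𝟙 (a ≤? c)) (∑-mono-≤ M λ b _ → ∑-same-product≤ M (suc a) (suc b) (suc c))) ⟩
    ∑[ a < M ] 𝟙 (a ≤? c) * (∑[ b < M ] 𝟙 (suc c ∣? suc a * suc b))
      ≡⟨ ∑-𝟙≤-truncate M c _ c<M ⟩
    ∑[ a < suc c ] ∑[ b < M ] 𝟙 (suc c ∣? suc a * suc b)
      ≤⟨ ∑∑-∣*≤ M c c<M ⟩
    M * τ M (suc c)
      ∎
    where
    pull-out : ∀ a → ∑[ b < M ] ∑[ d < M ] H a b c d
                     ≡ 𝟙 (a ≤? c) * (∑[ b < M ] ∑[ d < M ] 𝟙 (suc a * suc b ≟ suc c * suc d))
    pull-out a = trans (∑-cong M λ b _ → sym (*-distribˡ-∑ M (𝟙 (a ≤? c)) λ d → 𝟙 (suc a * suc b ≟ suc c * suc d)))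
                       (sym (*-distribˡ-∑ M (𝟙 (a ≤? c)) λ b → ∑[ d < M ] 𝟙 (suc a * suc b ≟ suc c * suc d)))

energy≤ : ∀ M K → M ≤ 2 ^ K → energy M ≤ 2 * (M * (suc K * M))
energy≤ M K M≤2^K = begin
  energy M                                   ≤⟨ ∑⁴-mono-≤ M split ⟩
  ∑⁴ M (λ a b c d → H a b c d + H c d a b)   ≡⟨ ∑⁴-distrib-+ M H (λ a b c d → H c d a b) ⟩
  ∑⁴ M H + ∑⁴ M (λ a b c d → H c d a b)      ≡⟨ cong (∑⁴ M H +_) (∑⁴-swap-pairs M H) ⟩
  ∑⁴ M H + ∑⁴ M H                            ≡⟨ cong (∑⁴ M H +_) (+-identityʳ _) ⟨
  2 * ∑⁴ M H                                 ≤⟨ *-monoʳ-≤ 2 (ordered-energy≤ M K M≤2^K) ⟩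
  2 * (M * (suc K * M))                      ∎
  where
  open ≤-Reasoning
  H : ℕ → ℕ → ℕ → ℕ → ℕ
  H a b c d = 𝟙 (a ≤? c) * 𝟙 (suc a * suc b ≟ suc c * suc d)
  split : ∀ a b c d → 𝟙 (suc a * suc b ≟ suc c * suc d) ≤ H a b c d + H c d a b
  split a b c d with ≤-total a c
  ... | inj₁ a≤c = ≤-trans (≤-reflexive (sym (𝟙-yes-* (a ≤? c) a≤c _))) (m≤m+n _ _)
  ... | inj₂ c≤a = ≤-trans (≤-reflexive (trans (𝟙-cong (_ ≟ _) (_ ≟ _) sym sym) (sym (𝟙-yes-* (c ≤? a) c≤a _))))
                           (m≤n+m _ _)

-- Sums of two squares

<-mono⇒injective : ∀ (f : ℕ → ℕ) → (∀ {m n} → m < n → f m < f n) → ∀ {m n} → f m ≡ f n → m ≡ n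
<-mono⇒injective f f-mono {m} {n} fm≡fn with <-cmp m n
... | tri< m<n _ _ = contradiction fm≡fn (<⇒≢ (f-mono m<n))
... | tri≈ _ m≡n _ = m≡n
... | tri> _ _ n<m = contradiction (sym fm≡fn) (<⇒≢ (f-mono n<m))

norm : ℕ → ℕ → ℕ
norm X Y = X * X + Y * Y

[m∸n]*[m+n]≡m*m∸n*n : ∀ m n → (m ∸ n) * (m + n) ≡ m * m ∸ n * n
[m∸n]*[m+n]≡m*m∸n*n m n = begin
  (m ∸ n) * (m + n)                   ≡⟨ *-distribʳ-∸ (m + n) m n ⟩
  m * (m + n) ∸ n * (m + n)           ≡⟨ cong₂ _∸_ (*-distribˡ-+ m m n) (*-distribˡ-+ n m n) ⟩
  (m * m + m * n) ∸ (n * m + n * n)   ≡⟨ cong₂ (λ x y → x ∸ (y + n * n)) (+-comm (m * m) (m * n)) (*-comm n m) ⟩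
  (m * n + m * m) ∸ (m * n + n * n)   ≡⟨ [m+n]∸[m+o]≡n∸o (m * n) (m * m) (n * n) ⟩
  m * m ∸ n * n                       ∎
  where open ≡-Reasoning

m+n≡o+p⇒m∸o≡p∸n : ∀ m n o p → m + n ≡ o + p → m ∸ o ≡ p ∸ n
m+n≡o+p⇒m∸o≡p∸n m n o p eq = begin
  m ∸ o              ≡⟨ [m+n]∸[m+o]≡n∸o n m o ⟨
  (n + m) ∸ (n + o)  ≡⟨ cong₂ _∸_ (trans (+-comm n m) eq) (+-comm n o) ⟩
  (o + p) ∸ (o + n)  ≡⟨ [m+n]∸[m+o]≡n∸o o p n ⟩
  p ∸ n              ∎
  where open ≡-Reasoning

equal-norms⇒ : ∀ X Y Z W → Z < X → norm X Y ≡ norm Z W → Y < W × (X ∸ Z) * (X + Z) ≡ (W ∸ Y) * (W + Y)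
equal-norms⇒ X Y Z W Z<X eq = Y<W , (begin
  (X ∸ Z) * (X + Z)  ≡⟨ [m∸n]*[m+n]≡m*m∸n*n X Z ⟩
  X * X ∸ Z * Z      ≡⟨ m+n≡o+p⇒m∸o≡p∸n (X * X) (Y * Y) (Z * Z) (W * W) eq ⟩
  W * W ∸ Y * Y      ≡⟨ [m∸n]*[m+n]≡m*m∸n*n W Y ⟨
  (W ∸ Y) * (W + Y)  ∎)
  where
  open ≡-Reasoning
  Y<W : Y < W
  Y<W = ≰⇒> λ W≤Y → <⇒≢ (+-mono-<-≤ (*-mono-< Z<X Z<X) (*-mono-≤ W≤Y W≤Y)) (sym eq)

collision : ℕ → ℕ → ℕ → ℕ → ℕ
collision X Y Z W = 𝟙 (Z <? X) * (𝟙 (Y <? W) * 𝟙 ((X ∸ Z) * (X + Z) ≟ (W ∸ Y) * (W + Y)))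

collision≡1 : ∀ X Y Z W → Z < X → norm X Y ≡ norm Z W → collision X Y Z W ≡ 1
collision≡1 X Y Z W Z<X eq with equal-norms⇒ X Y Z W Z<X eq
... | Y<W , eq′ = cong₂ _*_ (𝟙-yes (Z <? X) Z<X) (cong₂ _*_ (𝟙-yes (Y <? W) Y<W) (𝟙-yes (_ ≟ _) eq′))

𝟙-norm≤ : ∀ X Y Z W →
  𝟙 (norm X Y ≟ norm Z W) ≤ 𝟙 (X ≟ Z) * 𝟙 (Y ≟ W) + (collision X Y Z W + collision Z W X Y)
𝟙-norm≤ X Y Z W with norm X Y ≟ norm Z W | <-cmp X Z
... | no _ | _ = z≤n
... | yes eq | tri< X<Z _ _ =
  ≤-trans (≤-reflexive (sym (collision≡1 Z W X Y X<Z (sym eq)))) (≤-trans (m≤n+m (collision Z W X Y) (collision X Y Z W)) (m≤n+m _ (𝟙 (X ≟ Z) * 𝟙 (Y ≟ W))))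
... | yes eq | tri> _ _ Z<X =
  ≤-trans (≤-reflexive (sym (collision≡1 X Y Z W Z<X eq))) (≤-trans (m≤m+n (collision X Y Z W) (collision Z W X Y)) (m≤n+m _ (𝟙 (X ≟ Z) * 𝟙 (Y ≟ W))))
... | yes eq | tri≈ _ refl _ = ≤-trans (≤-reflexive (sym diagonal≡1)) (m≤m+n _ _)
  where
  diagonal≡1 : 𝟙 (X ≟ X) * 𝟙 (Y ≟ W) ≡ 1
  diagonal≡1 = cong₂ _*_ (𝟙-yes (X ≟ X) refl)
    (𝟙-yes (Y ≟ W) (<-mono⇒injective (λ k → k * k) (λ k<l → *-mono-< k<l k<l) (+-cancelˡ-≡ (X * X) (Y * Y) (W * W) eq)))

-- (X, Z) ↦ (X − Z, X + Z) is injective on Z < X; it is applied in two steps,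
-- X ↦ X ∸ suc Z for fixed Z and then Z ↦ a + 2Z for fixed a = X ∸ suc Z.
∑-diff-sum≤ : ∀ n (g : ℕ → ℕ → ℕ) →
  ∑[ X < n ] ∑[ Z < n ] 𝟙 (Z <? X) * g (X ∸ Z) (X + Z) ≤ ∑[ a < 3 * n ] ∑[ b < 3 * n ] g (suc a) (suc b)
∑-diff-sum≤ n g = begin
  ∑[ X < n ] ∑[ Z < n ] 𝟙 (Z <? X) * g (X ∸ Z) (X + Z)  ≡⟨ ∑-comm n n _ ⟩
  ∑[ Z < n ] ∑[ X < n ] 𝟙 (Z <? X) * g (X ∸ Z) (X + Z)  ≡⟨ ∑-cong n (λ Z _ → ∑-cong n λ X _ → reparametrise Z X) ⟩
  ∑[ Z < n ] ∑[ X < n ] 𝟙 (Z <? X) * h Z (X ∸ suc Z)     ≤⟨ ∑-mono-≤ n (λ Z _ → ∑-reindex-≤ n n (Z <?_) (_∸ suc Z) (h Z)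
                                                              (λ {X} X<n _ → ≤-<-trans (m∸n≤m X (suc Z)) X<n)
                                                              (λ _ _ → ∸-suc-injective)) ⟩
  ∑[ Z < n ] ∑[ a < n ] h Z a                           ≡⟨ ∑-comm n n _ ⟩
  ∑[ a < n ] ∑[ Z < n ] g (suc a) (suc (a + (Z + Z)))   ≤⟨ ∑-mono-≤ n (λ a a<n → ∑-injective-≤ n (3 * n) (λ Z → a + (Z + Z)) (g (suc a) ∘ suc)
                                                              (a+2Z<3n a<n) (λ _ _ → double-injective ∘ +-cancelˡ-≡ a _ _)) ⟩
  ∑[ a < n ] ∑[ b < 3 * n ] g (suc a) (suc b)           ≤⟨ ∑-mono-range _ (m≤n*m n 3) ⟩
  ∑[ a < 3 * n ] ∑[ b < 3 * n ] g (suc a) (suc b)       ∎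
  where
  open ≤-Reasoning
  h : ℕ → ℕ → ℕ
  h Z a = g (suc a) (suc (a + (Z + Z)))
  reparametrise : ∀ Z X → 𝟙 (Z <? X) * g (X ∸ Z) (X + Z) ≡ 𝟙 (Z <? X) * h Z (X ∸ suc Z)
  reparametrise Z X with Z <? X
  ... | no _ = refl
  ... | yes Z<X = cong (λ t → 1 * t) (cong₂ g (+-∸-assoc 1 Z<X) (begin-equality
    X + Z                      ≡⟨ cong (_+ Z) (m+[n∸m]≡n Z<X) ⟨
    suc Z + (X ∸ suc Z) + Z    ≡⟨ cong (λ t → suc (t + Z)) (+-comm Z (X ∸ suc Z)) ⟩
    suc (X ∸ suc Z + Z + Z)    ≡⟨ cong suc (+-assoc (X ∸ suc Z) Z Z) ⟩
    suc (X ∸ suc Z + (Z + Z))  ∎))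
  ∸-suc-injective : ∀ {Z X X′} → Z < X → Z < X′ → X ∸ suc Z ≡ X′ ∸ suc Z → X ≡ X′
  ∸-suc-injective {Z} Z<X Z<X′ eq = trans (sym (m∸n+n≡m Z<X)) (trans (cong (_+ suc Z) eq) (m∸n+n≡m Z<X′))
  double-injective : ∀ {Z Z′} → Z + Z ≡ Z′ + Z′ → Z ≡ Z′
  double-injective = <-mono⇒injective (λ k → k + k) (λ k<l → +-mono-< k<l k<l)
  a+2Z<3n : ∀ {a} → a < n → ∀ {Z} → Z < n → a + (Z + Z) < 3 * n
  a+2Z<3n a<n Z<n = +-mono-<-≤ a<n (≤-trans (+-mono-≤ (<⇒≤ Z<n) (<⇒≤ Z<n)) (≤-reflexive (cong (n +_) (sym (+-identityʳ n)))))

diagonal-sum≤ : ∀ n → ∑⁴ n (λ X Y Z W → 𝟙 (X ≟ Z) * 𝟙 (Y ≟ W)) ≤ n * n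
diagonal-sum≤ n = begin
  ∑[ X < n ] ∑[ Y < n ] ∑[ Z < n ] ∑[ W < n ] 𝟙 (X ≟ Z) * 𝟙 (Y ≟ W)  ≤⟨ ∑-mono-≤ n (λ X _ → ∑-mono-≤ n λ Y _ → diagonal≤1 X Y) ⟩
  ∑[ X < n ] ∑[ Y < n ] 1                                           ≡⟨ ∑-cong n (λ _ _ → trans (∑-const n 1) (*-identityʳ n)) ⟩
  ∑[ X < n ] n                                                      ≡⟨ ∑-const n n ⟩
  n * n                                                             ∎
  where
  open ≤-Reasoning
  ∑-𝟙-≟≤1 : ∀ x → ∑[ i < n ] 𝟙 (x ≟ i) ≤ 1
  ∑-𝟙-≟≤1 x = ∑-𝟙-unique≤1 n (x ≟_) λ _ _ x≡i x≡j → trans (sym x≡i) x≡j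
  diagonal≤1 : ∀ X Y → ∑[ Z < n ] ∑[ W < n ] 𝟙 (X ≟ Z) * 𝟙 (Y ≟ W) ≤ 1
  diagonal≤1 X Y = begin
    ∑[ Z < n ] ∑[ W < n ] 𝟙 (X ≟ Z) * 𝟙 (Y ≟ W)  ≡⟨ ∑-cong n (λ Z _ → *-distribˡ-∑ n (𝟙 (X ≟ Z)) (λ W → 𝟙 (Y ≟ W))) ⟨
    ∑[ Z < n ] 𝟙 (X ≟ Z) * (∑[ W < n ] 𝟙 (Y ≟ W)) ≤⟨ ∑-mono-≤ n (λ Z _ → *-monoʳ-≤ (𝟙 (X ≟ Z)) (∑-𝟙-≟≤1 Y)) ⟩
    ∑[ Z < n ] 𝟙 (X ≟ Z) * 1                      ≡⟨ ∑-cong n (λ Z _ → *-identityʳ (𝟙 (X ≟ Z))) ⟩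
    ∑[ Z < n ] 𝟙 (X ≟ Z)                          ≤⟨ ∑-𝟙-≟≤1 X ⟩
    1                                             ∎

collision-sum≤ : ∀ n → ∑⁴ n collision ≤ energy (3 * n)
collision-sum≤ n = begin
  ∑[ X < n ] ∑[ Y < n ] ∑[ Z < n ] ∑[ W < n ] collision X Y Z W  ≡⟨ ∑-cong n (λ X _ → ∑-comm n n _) ⟩
  ∑[ X < n ] ∑[ Z < n ] ∑[ Y < n ] ∑[ W < n ] collision X Y Z W  ≡⟨ ∑-cong n (λ X _ → ∑-cong n λ Z _ → pull-out X Z) ⟩
  ∑[ X < n ] ∑[ Z < n ] 𝟙 (Z <? X) * G (X ∸ Z) (X + Z)           ≤⟨ ∑-diff-sum≤ n G ⟩
  ∑[ a < 3 * n ] ∑[ b < 3 * n ] G (suc a) (suc b)                 ≤⟨ ∑-mono-≤ (3 * n) (λ a _ → ∑-mono-≤ (3 * n) λ b _ → G≤ (suc a) (suc b)) ⟩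
  energy (3 * n)                                                  ∎
  where
  open ≤-Reasoning
  G : ℕ → ℕ → ℕ
  G α β = ∑[ Y < n ] ∑[ W < n ] 𝟙 (Y <? W) * 𝟙 (α * β ≟ (W ∸ Y) * (W + Y))
  pull-out : ∀ X Z → ∑[ Y < n ] ∑[ W < n ] collision X Y Z W ≡ 𝟙 (Z <? X) * G (X ∸ Z) (X + Z)
  pull-out X Z = trans
    (∑-cong n λ Y _ → sym (*-distribˡ-∑ n (𝟙 (Z <? X)) λ W → 𝟙 (Y <? W) * 𝟙 ((X ∸ Z) * (X + Z) ≟ (W ∸ Y) * (W + Y))))
    (sym (*-distribˡ-∑ n (𝟙 (Z <? X)) λ Y → ∑[ W < n ] 𝟙 (Y <? W) * 𝟙 ((X ∸ Z) * (X + Z) ≟ (W ∸ Y) * (W + Y))))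
  G≤ : ∀ α β → G α β ≤ ∑[ c < 3 * n ] ∑[ d < 3 * n ] 𝟙 (α * β ≟ suc c * suc d)
  G≤ α β = begin
    ∑[ Y < n ] ∑[ W < n ] 𝟙 (Y <? W) * 𝟙 (α * β ≟ (W ∸ Y) * (W + Y))  ≡⟨ ∑-comm n n _ ⟩
    ∑[ W < n ] ∑[ Y < n ] 𝟙 (Y <? W) * 𝟙 (α * β ≟ (W ∸ Y) * (W + Y))  ≤⟨ ∑-diff-sum≤ n (λ γ δ → 𝟙 (α * β ≟ γ * δ)) ⟩
    ∑[ c < 3 * n ] ∑[ d < 3 * n ] 𝟙 (α * β ≟ suc c * suc d)           ∎

equalNorms : ℕ → ℕ
equalNorms n = ∑⁴ n λ X Y Z W → 𝟙 (norm X Y ≟ norm Z W)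

equalNorms≤ : ∀ n → equalNorms n ≤ n * n + 2 * energy (3 * n)
equalNorms≤ n = begin
  equalNorms n                                      ≤⟨ ∑⁴-mono-≤ n 𝟙-norm≤ ⟩
  ∑⁴ n (λ X Y Z W → D X Y Z W + (C X Y Z W + C Z W X Y))
    ≡⟨ ∑⁴-distrib-+ n D (λ X Y Z W → C X Y Z W + C Z W X Y) ⟩
  ∑⁴ n D + ∑⁴ n (λ X Y Z W → C X Y Z W + C Z W X Y)
    ≡⟨ cong (∑⁴ n D +_) (trans (∑⁴-distrib-+ n C (λ X Y Z W → C Z W X Y)) (cong (∑⁴ n C +_) (∑⁴-swap-pairs n C))) ⟩
  ∑⁴ n D + (∑⁴ n C + ∑⁴ n C)                         ≤⟨ +-mono-≤ (diagonal-sum≤ n) (+-mono-≤ (collision-sum≤ n) (collision-sum≤ n)) ⟩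
  n * n + (energy (3 * n) + energy (3 * n))         ≡⟨ cong (λ t → n * n + (energy (3 * n) + t)) (+-identityʳ _) ⟨
  n * n + 2 * energy (3 * n)                        ∎
  where
  open ≤-Reasoning
  C = collision
  D : ℕ → ℕ → ℕ → ℕ → ℕ
  D X Y Z W = 𝟙 (X ≟ Z) * 𝟙 (Y ≟ W)

-- Equidistant triples in the grid

grid : ∀ n → List (Point n)
grid n = cartesianProduct (allFin n) (allFin n)

grid-unique : ∀ {n} → Unique (grid n)
grid-unique {n} = cartesianProduct⁺ (allFin⁺ n) (allFin⁺ n)

grid-complete : ∀ {n} (p : Point n) → p ∈ grid n
grid-complete (i , j) = ∈-cartesianProduct⁺ (∈-allFin i) (∈-allFin j)

∑-grid : ∀ n (f : Point n → ℕ) (F : ℕ → ℕ → ℕ) → (∀ i j → f (i , j) ≡ F (toℕ i) (toℕ j)) →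
  ∑∈ (grid n) f ≡ ∑[ x < n ] ∑[ y < n ] F x y
∑-grid n f F f≡F = trans (∑∈-cartesianProduct (allFin n) (allFin n) f)
  (∑∈-tabulate n (λ i → i) _ _ λ i → ∑∈-tabulate n (λ j → j) _ _ (f≡F i))

∑-∣-∣≤ : ∀ n b (h : ℕ → ℕ) → b < n → ∑[ i < n ] h ∣ i - b ∣ ≤ 2 * ∑< n h
∑-∣-∣≤ n b h b<n = begin
  ∑[ i < n ] h ∣ i - b ∣                                         ≤⟨ ∑-mono-≤ n (λ i _ → split i) ⟩
  (∑[ i < n ] 𝟙 (b ≤? i) * h (i ∸ b) + 𝟙 (i <? b) * h (b ∸ i))   ≡⟨ ∑-distrib-+ n _ _ ⟩
  (∑[ i < n ] 𝟙 (b ≤? i) * h (i ∸ b)) + (∑[ i < n ] 𝟙 (i <? b) * h (b ∸ i))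
    ≤⟨ +-mono-≤ (∑-reindex-≤ n n (b ≤?_) (_∸ b) h (λ {i} i<n _ → ≤-<-trans (m∸n≤m i b) i<n)
                  (λ _ _ b≤i b≤j eq → trans (sym (m∸n+n≡m b≤i)) (trans (cong (_+ b) eq) (m∸n+n≡m b≤j))))
                (∑-reindex-≤ n n (_<? b) (b ∸_) h (λ {i} _ _ → ≤-<-trans (m∸n≤m b i) b<n)
                  (λ _ _ i<b j<b → ∸-cancelˡ-≡ (<⇒≤ i<b) (<⇒≤ j<b))) ⟩
  ∑< n h + ∑< n h                                                ≡⟨ cong (∑< n h +_) (+-identityʳ _) ⟨
  2 * ∑< n h                                                     ∎
  where
  open ≤-Reasoning
  split : ∀ i → h ∣ i - b ∣ ≤ 𝟙 (b ≤? i) * h (i ∸ b) + 𝟙 (i <? b) * h (b ∸ i)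
  split i with b ≤? i | i <? b
  ... | yes b≤i | _ = ≤-trans (≤-reflexive (trans (cong h (m≤n⇒∣n-m∣≡n∸m b≤i)) (sym (+-identityʳ _)))) (m≤m+n _ _)
  ... | no _ | yes i<b = ≤-reflexive (trans (cong h (m≤n⇒∣m-n∣≡n∸m (<⇒≤ i<b))) (sym (+-identityʳ _)))
  ... | no b≰i | no i≮b = contradiction (≰⇒> b≰i) i≮b

∑-∣-∣-scale≤ : ∀ n b c {H K : ℕ → ℕ} → b < n → (∀ X → H X ≤ c * K X) → ∑[ i < n ] H ∣ i - b ∣ ≤ 2 * c * ∑< n K
∑-∣-∣-scale≤ n b c {H} {K} b<n H≤cK = begin
  ∑[ i < n ] H ∣ i - b ∣    ≤⟨ ∑-∣-∣≤ n b H b<n ⟩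
  2 * ∑< n H               ≤⟨ *-monoʳ-≤ 2 (∑-mono-≤ n λ X _ → H≤cK X) ⟩
  2 * (∑[ X < n ] c * K X) ≡⟨ cong (2 *_) (*-distribˡ-∑ n c K) ⟨
  2 * (c * ∑< n K)         ≡⟨ *-assoc 2 c _ ⟨
  2 * c * ∑< n K           ∎
  where open ≤-Reasoning

-- Each of the four maps i ↦ ∣ i - b ∣ is at most two-to-one.
equidistant-around≤ : ∀ n b₁ b₂ → b₁ < n → b₂ < n →
  ∑[ a₁ < n ] ∑[ a₂ < n ] ∑[ c₁ < n ] ∑[ c₂ < n ] 𝟙 (norm ∣ a₁ - b₁ ∣ ∣ a₂ - b₂ ∣ ≟ norm ∣ c₁ - b₁ ∣ ∣ c₂ - b₂ ∣)
    ≤ 16 * equalNorms n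
equidistant-around≤ n b₁ b₂ b₁<n b₂<n =
  ∑-∣-∣-scale≤ n b₁ 8 {λ X → ∑[ a₂ < n ] around X ∣ a₂ - b₂ ∣} {λ X → ∑[ Y < n ] partial X Y} b₁<n λ X →
  ∑-∣-∣-scale≤ n b₂ 4 {around X} {partial X} b₂<n λ Y →
  ∑-∣-∣-scale≤ n b₁ 2 {λ Z → ∑[ c₂ < n ] E X Y Z ∣ c₂ - b₂ ∣} {λ Z → ∑[ W < n ] E X Y Z W} b₁<n λ Z →
  ∑-∣-∣-scale≤ n b₂ 1 {E X Y Z} {E X Y Z} b₂<n λ W →
  ≤-reflexive (sym (*-identityˡ _))
  where
  E : ℕ → ℕ → ℕ → ℕ → ℕ
  E X Y Z W = 𝟙 (norm X Y ≟ norm Z W)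
  around partial : ℕ → ℕ → ℕ
  around X Y = ∑[ c₁ < n ] ∑[ c₂ < n ] E X Y ∣ c₁ - b₁ ∣ ∣ c₂ - b₂ ∣
  partial X Y = ∑[ Z < n ] ∑[ W < n ] E X Y Z W

equidistantTriples : ℕ → ℕ
equidistantTriples n = ∑[ a ∈ grid n ] ∑[ b ∈ grid n ] ∑[ c ∈ grid n ] 𝟙 (dist² a b ≟ dist² b c)

equidistantTriples≤ : ∀ n → equidistantTriples n ≤ n * (n * (16 * equalNorms n))
equidistantTriples≤ n = begin
  equidistantTriples n
    ≡⟨ ∑∈-comm (grid n) (grid n) _ ⟩
  ∑[ b ∈ grid n ] ∑[ a ∈ grid n ] ∑[ c ∈ grid n ] 𝟙 (dist² a b ≟ dist² b c)
    ≡⟨ ∑-grid n _ _ (λ i j → ∑-grid n _ _ λ k l → ∑-grid n _ _ λ p q →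
         cong₂ (λ u v → 𝟙 (dist² (k , l) (i , j) ≟ norm u v)) (∣-∣-comm (toℕ i) (toℕ p)) (∣-∣-comm (toℕ j) (toℕ q))) ⟩
  ∑[ b₁ < n ] ∑[ b₂ < n ] ∑[ a₁ < n ] ∑[ a₂ < n ] ∑[ c₁ < n ] ∑[ c₂ < n ]
    𝟙 (norm ∣ a₁ - b₁ ∣ ∣ a₂ - b₂ ∣ ≟ norm ∣ c₁ - b₁ ∣ ∣ c₂ - b₂ ∣)
    ≤⟨ ∑-mono-≤ n (λ b₁ b₁<n → ∑-mono-≤ n λ b₂ b₂<n → equidistant-around≤ n b₁ b₂ b₁<n b₂<n) ⟩
  ∑[ b₁ < n ] ∑[ b₂ < n ] 16 * equalNorms n
    ≡⟨ trans (∑-cong n λ _ _ → ∑-const n _) (∑-const n _) ⟩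
  n * (n * (16 * equalNorms n))
    ∎
  where open ≤-Reasoning

-- The deletion method

falling₃ : ℕ → ℕ
falling₃ k = k * ((k ∸ 1) * (k ∸ 2))

no-triples-left : ∀ c e e′ .{{_ : NonZero c}} → c ≤ 3 → c * e′ + 3 * e ≤ c * e → e′ ≡ 0
no-triples-left c e e′ c≤3 step = n≤0⇒n≡0 (≤-trans (m≤n*m e′ c)
  (+-cancelʳ-≤ (3 * e) (c * e′) 0 (≤-trans step (*-monoˡ-≤ e c≤3))))

-- e′ / falling₃ u ≤ e / falling₃ (suc u) with denominators cleared: a deletion step from suc u points
-- (the first hypothesis) does not increase the density of triples.
falling-ratio : ∀ u e e′ r s → suc u * e′ + 3 * e ≤ suc u * e → e * r ≤ s * falling₃ (suc u) → e′ * r ≤ s * falling₃ u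
falling-ratio 0 e e′ r _ step _ = ≤-trans (≤-reflexive (cong (_* r) (no-triples-left 1 e e′ (s≤s z≤n) step))) z≤n
falling-ratio 1 e e′ r _ step _ = ≤-trans (≤-reflexive (cong (_* r) (no-triples-left 2 e e′ (s≤s (s≤s z≤n)) step))) z≤n
falling-ratio (suc (suc w)) e e′ r s step e-bound = *-cancelˡ-≤ (3 + w) (begin
  (3 + w) * (e′ * r)               ≡⟨ *-assoc (3 + w) e′ r ⟨
  (3 + w) * e′ * r                 ≤⟨ *-monoˡ-≤ r (+-cancelʳ-≤ (3 * e) ((3 + w) * e′) (w * e) step′) ⟩
  w * e * r                        ≡⟨ *-assoc w e r ⟩
  w * (e * r)                      ≤⟨ *-monoʳ-≤ w e-bound ⟩
  w * (s * falling₃ (3 + w))       ≡⟨ falling-identity w s ⟩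
  (3 + w) * (s * falling₃ (2 + w)) ∎)
  where
  open ≤-Reasoning
  step′ : (3 + w) * e′ + 3 * e ≤ w * e + 3 * e
  step′ = ≤-trans step (≤-reflexive (trans (*-distribʳ-+ e 3 w) (+-comm (3 * e) (w * e))))
  falling-identity : ∀ w s → w * (s * (suc (suc (suc w)) * (suc (suc w) * suc w)))
                           ≡ suc (suc (suc w)) * (s * (suc (suc w) * (suc w * w)))
  falling-identity = solve-∀

cube≤4*falling₃ : ∀ N → 4 ≤ N → N * N * N ≤ 4 * falling₃ N
cube≤4*falling₃ 0 ()
cube≤4*falling₃ 1 (s≤s ())
cube≤4*falling₃ 2 (s≤s (s≤s ()))
cube≤4*falling₃ 3 (s≤s (s≤s (s≤s ())))
cube≤4*falling₃ (suc (suc (suc (suc u)))) _ = ≤-trans (m≤m+n _ _) (≤-reflexive (sym (expand u)))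
  where
  expand : ∀ u → 4 * ((4 + u) * ((3 + u) * (2 + u))) ≡ (4 + u) * (4 + u) * (4 + u) + (4 + u) * (3 * u * u + 12 * u + 8)
  expand = solve-∀

falling₃≤cube : ∀ k → falling₃ k ≤ k * k * k
falling₃≤cube k = ≤-trans (*-monoʳ-≤ k (*-mono-≤ (m∸n≤m k 1) (m∸n≤m k 2))) (≤-reflexive (sym (*-assoc k k k)))

module Deletion {A : Set} (_≟ᴬ_ : DecidableEquality A) (G : List A) (G-unique : Unique G) (G-complete : ∀ x → x ∈ G)
                (I : A → A → A → ℕ) (I-distinct : ∀ {a b c} → I a b c ≢ 0 → a ≢ b × b ≢ c × a ≢ c) where

  Subset : Set
  Subset = A → Bool

  ⟦_⟧ : Bool → ℕ
  ⟦ b ⟧ = 𝟙 (T? b)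

  members : Subset → List A
  members χ = filter (T? ∘ χ) G

  size : Subset → ℕ
  size χ = ∑[ a ∈ G ] ⟦ χ a ⟧

  mask : Subset → A → A → A → ℕ
  mask χ a b c = ⟦ χ a ⟧ * (⟦ χ b ⟧ * ⟦ χ c ⟧)

  weight : Subset → A → A → A → ℕ
  weight χ a b c = mask χ a b c * I a b c

  ∑³ : (A → A → A → ℕ) → ℕ
  ∑³ F = ∑[ a ∈ G ] ∑[ b ∈ G ] ∑[ c ∈ G ] F a b c

  triples : Subset → ℕ
  triples χ = ∑³ (weight χ)

  hits : A → A → A → A → ℕ
  hits x a b c = 𝟙 (x ≟ᴬ a) + (𝟙 (x ≟ᴬ b) + 𝟙 (x ≟ᴬ c))

  degree : Subset → A → ℕ
  degree χ x = ∑³ λ a b c → weight χ a b c * hits x a b c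

  remove : A → Subset → Subset
  remove x χ a = χ a ∧ not (does (a ≟ᴬ x))

  remove-self : ∀ x χ → remove x χ x ≡ false
  remove-self x χ with x ≟ᴬ x
  ... | yes _ = ∧-zeroʳ (χ x)
  ... | no x≢x = contradiction refl x≢x

  remove-other : ∀ {x a} χ → x ≢ a → remove x χ a ≡ χ a
  remove-other {x} {a} χ x≢a with a ≟ᴬ x
  ... | yes a≡x = contradiction (sym a≡x) x≢a
  ... | no _ = ∧-identityʳ (χ a)

  length-members≡size : ∀ χ → length (members χ) ≡ size χ
  length-members≡size χ = length-filter (T? ∘ χ) G

  ∑³-cong : ∀ {F F′ : A → A → A → ℕ} → (∀ a b c → F a b c ≡ F′ a b c) → ∑³ F ≡ ∑³ F′
  ∑³-cong F≡F′ = ∑∈-cong G λ a → ∑∈-cong G λ b → ∑∈-cong G λ c → F≡F′ a b c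

  ∑³-distrib-+ : ∀ (F F′ : A → A → A → ℕ) → ∑³ (λ a b c → F a b c + F′ a b c) ≡ ∑³ F + ∑³ F′
  ∑³-distrib-+ F F′ =
    trans (∑∈-cong G λ a → trans (∑∈-cong G λ b → ∑∈-distrib-+ G (F a b) (F′ a b))
                                 (∑∈-distrib-+ G (λ b → ∑∈ G (F a b)) (λ b → ∑∈ G (F′ a b))))
          (∑∈-distrib-+ G (λ a → ∑[ b ∈ G ] ∑∈ G (F a b)) (λ a → ∑[ b ∈ G ] ∑∈ G (F′ a b)))

  *-distribˡ-∑³ : ∀ k (F : A → A → A → ℕ) → k * ∑³ F ≡ ∑³ (λ a b c → k * F a b c)
  *-distribˡ-∑³ k F =
    trans (*-distribˡ-∑∈ G k _) (∑∈-cong G λ a →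
    trans (*-distribˡ-∑∈ G k _) (∑∈-cong G λ b → *-distribˡ-∑∈ G k (F a b)))

  ∑∈-∑³-comm : ∀ (F : A → A → A → A → ℕ) → ∑[ x ∈ G ] ∑³ (F x) ≡ ∑³ (λ a b c → ∑[ x ∈ G ] F x a b c)
  ∑∈-∑³-comm F =
    trans (∑∈-comm G G _) (∑∈-cong G λ a →
    trans (∑∈-comm G G _) (∑∈-cong G λ b → ∑∈-comm G G (λ x c → F x a b c)))

  -- Since a, b, c are distinct, x occupies at most one of the three positions.
  mask-remove : ∀ x χ {a b c} → a ≢ b → b ≢ c → a ≢ c →
    mask χ a b c ≡ mask (remove x χ) a b c + mask χ a b c * hits x a b c
  mask-remove x χ {a} {b} {c} a≢b b≢c a≢c with x ≟ᴬ a | x ≟ᴬ b | x ≟ᴬ c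
  ... | yes refl | yes refl | _ = contradiction refl a≢b
  ... | yes refl | _ | yes refl = contradiction refl a≢c
  ... | _ | yes refl | yes refl = contradiction refl b≢c
  ... | no x≢a | no x≢b | no x≢c
    rewrite remove-other χ x≢a | remove-other χ x≢b | remove-other χ x≢c =
    sym (trans (cong (mask χ a b c +_) (*-zeroʳ (mask χ a b c))) (+-identityʳ _))
  ... | yes refl | no _ | no _ rewrite remove-self x χ = sym (*-identityʳ _)
  ... | no x≢a | yes refl | no _
    rewrite remove-other χ x≢a | remove-self x χ =
    sym (cong₂ _+_ (*-zeroʳ ⟦ χ a ⟧) (*-identityʳ _))
  ... | no x≢a | no x≢b | yes refl
    rewrite remove-other χ x≢a | remove-other χ x≢b | remove-self x χ =
    sym (cong₂ _+_ (trans (cong (⟦ χ a ⟧ *_) (*-zeroʳ ⟦ χ b ⟧)) (*-zeroʳ ⟦ χ a ⟧)) (*-identityʳ _))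

  weight-remove : ∀ x χ a b c → weight χ a b c ≡ weight (remove x χ) a b c + weight χ a b c * hits x a b c
  weight-remove x χ a b c with I a b c ≟ 0
  ... | yes I≡0 rewrite I≡0 =
    trans (*-zeroʳ (mask χ a b c))
          (sym (cong₂ _+_ (*-zeroʳ (mask (remove x χ) a b c)) (cong (_* hits x a b c) (*-zeroʳ (mask χ a b c)))))
  ... | no I≢0 with I-distinct I≢0
  ... | a≢b , b≢c , a≢c = begin
    m * i                  ≡⟨ cong (_* i) (mask-remove x χ a≢b b≢c a≢c) ⟩
    (m′ + m * h) * i       ≡⟨ *-distribʳ-+ i m′ (m * h) ⟩
    m′ * i + m * h * i     ≡⟨ cong (m′ * i +_) (trans (*-assoc m h i) (trans (cong (m *_) (*-comm h i)) (sym (*-assoc m i h)))) ⟩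
    m′ * i + m * i * h     ∎
    where
    open ≡-Reasoning
    m = mask χ a b c
    m′ = mask (remove x χ) a b c
    h = hits x a b c
    i = I a b c

  triples-remove : ∀ x χ → triples χ ≡ triples (remove x χ) + degree χ x
  triples-remove x χ = trans (∑³-cong (weight-remove x χ)) (∑³-distrib-+ _ _)

  hits-sum : ∀ (χ : Subset) a b c → ∑[ x ∈ G ] ⟦ χ x ⟧ * hits x a b c ≡ ⟦ χ a ⟧ + (⟦ χ b ⟧ + ⟦ χ c ⟧)
  hits-sum χ a b c = begin
    ∑[ x ∈ G ] ⟦ χ x ⟧ * hits x a b c
      ≡⟨ ∑∈-cong G distribute ⟩
    ∑[ x ∈ G ] δ a x + (δ b x + δ c x)
      ≡⟨ trans (∑∈-distrib-+ G (δ a) (λ x → δ b x + δ c x)) (cong (∑∈ G (δ a) +_) (∑∈-distrib-+ G (δ b) (δ c))) ⟩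
    ∑∈ G (δ a) + (∑∈ G (δ b) + ∑∈ G (δ c))
      ≡⟨ cong₂ _+_ (pick a) (cong₂ _+_ (pick b) (pick c)) ⟩
    ⟦ χ a ⟧ + (⟦ χ b ⟧ + ⟦ χ c ⟧) ∎
    where
    open ≡-Reasoning
    δ : A → A → ℕ
    δ y x = ⟦ χ x ⟧ * 𝟙 (x ≟ᴬ y)
    distribute : ∀ x → ⟦ χ x ⟧ * hits x a b c ≡ δ a x + (δ b x + δ c x)
    distribute x = trans (*-distribˡ-+ ⟦ χ x ⟧ (𝟙 (x ≟ᴬ a)) _) (cong (δ a x +_) (*-distribˡ-+ ⟦ χ x ⟧ (𝟙 (x ≟ᴬ b)) (𝟙 (x ≟ᴬ c))))
    pick : ∀ y → ∑∈ G (δ y) ≡ ⟦ χ y ⟧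
    pick y = ∑∈-𝟙-≟ _≟ᴬ_ G-unique (G-complete y) (λ x → ⟦ χ x ⟧)

  weight-members : ∀ χ a b c → weight χ a b c * (⟦ χ a ⟧ + (⟦ χ b ⟧ + ⟦ χ c ⟧)) ≡ 3 * weight χ a b c
  weight-members χ a b c with χ a | χ b | χ c
  ... | true | true | true = *-comm (1 * I a b c) 3
  ... | false | _ | _ = refl
  ... | true | false | _ = refl
  ... | true | true | false = refl

  -- Every triple inside χ is counted once at each of its three distinct points.
  ∑-degree : ∀ χ → ∑[ x ∈ G ] ⟦ χ x ⟧ * degree χ x ≡ 3 * triples χ
  ∑-degree χ = begin
    ∑[ x ∈ G ] ⟦ χ x ⟧ * degree χ x
      ≡⟨ ∑∈-cong G (λ x → *-distribˡ-∑³ ⟦ χ x ⟧ λ a b c → weight χ a b c * hits x a b c) ⟩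
    ∑[ x ∈ G ] ∑³ (λ a b c → ⟦ χ x ⟧ * (weight χ a b c * hits x a b c))
      ≡⟨ ∑∈-∑³-comm (λ x a b c → ⟦ χ x ⟧ * (weight χ a b c * hits x a b c)) ⟩
    ∑³ (λ a b c → ∑[ x ∈ G ] ⟦ χ x ⟧ * (weight χ a b c * hits x a b c))
      ≡⟨ ∑³-cong (λ a b c → trans (∑∈-cong G λ x → x*[y*z]≡y*[x*z] ⟦ χ x ⟧ (weight χ a b c) (hits x a b c))
                                  (sym (*-distribˡ-∑∈ G (weight χ a b c) λ x → ⟦ χ x ⟧ * hits x a b c))) ⟩
    ∑³ (λ a b c → weight χ a b c * (∑[ x ∈ G ] ⟦ χ x ⟧ * hits x a b c))
      ≡⟨ ∑³-cong (λ a b c → trans (cong (weight χ a b c *_) (hits-sum χ a b c)) (weight-members χ a b c)) ⟩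
    ∑³ (λ a b c → 3 * weight χ a b c)
      ≡⟨ *-distribˡ-∑³ 3 (weight χ) ⟨
    3 * triples χ ∎
    where
    open ≡-Reasoning
    x*[y*z]≡y*[x*z] : ∀ x y z → x * (y * z) ≡ y * (x * z)
    x*[y*z]≡y*[x*z] x y z = trans (sym (*-assoc x y z)) (trans (cong (_* z) (*-comm x y)) (*-assoc y x z))

  size-remove : ∀ {x} χ → T (χ x) → size χ ≡ suc (size (remove x χ))
  size-remove {x} χ x∈χ = begin
    ∑[ a ∈ G ] ⟦ χ a ⟧                               ≡⟨ ∑∈-cong G split ⟩
    (∑[ a ∈ G ] ⟦ remove x χ a ⟧ + 1 * 𝟙 (a ≟ᴬ x))   ≡⟨ ∑∈-distrib-+ G (λ a → ⟦ remove x χ a ⟧) (λ a → 1 * 𝟙 (a ≟ᴬ x)) ⟩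
    size (remove x χ) + (∑[ a ∈ G ] 1 * 𝟙 (a ≟ᴬ x))  ≡⟨ cong (size (remove x χ) +_) (∑∈-𝟙-≟ _≟ᴬ_ G-unique (G-complete x) (λ _ → 1)) ⟩
    size (remove x χ) + 1                            ≡⟨ +-comm _ 1 ⟩
    suc (size (remove x χ))                          ∎
    where
    open ≡-Reasoning
    split : ∀ a → ⟦ χ a ⟧ ≡ ⟦ remove x χ a ⟧ + 1 * 𝟙 (a ≟ᴬ x)
    split a with a ≟ᴬ x
    ... | yes refl rewrite ∧-zeroʳ (χ a) = 𝟙-yes (T? (χ a)) x∈χ
    ... | no _ rewrite ∧-identityʳ (χ a) = sym (+-identityʳ _)

  deletion-step : ∀ χ → 1 ≤ size χ →
    ∃[ χ′ ] size χ ≡ suc (size χ′) × size χ * triples χ′ + 3 * triples χ ≤ size χ * triples χ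
  deletion-step χ size≥1 with members χ in members≡
  ... | [] = contradiction (subst (1 ≤_) (trans (sym (length-members≡size χ)) (cong length members≡)) size≥1) λ ()
  ... | x₀ ∷ xs = remove m χ , size-remove χ m∈χ , (begin
    size χ * triples (remove m χ) + 3 * triples χ          ≤⟨ +-monoʳ-≤ (size χ * triples (remove m χ)) three-triples≤ ⟩
    size χ * triples (remove m χ) + size χ * degree χ m    ≡⟨ *-distribˡ-+ (size χ) _ _ ⟨
    size χ * (triples (remove m χ) + degree χ m)           ≡⟨ cong (size χ *_) (triples-remove m χ) ⟨
    size χ * triples χ                                     ∎)
    where
    open ≤-Reasoning
    m = argmax (degree χ) x₀ xs
    chosen : All (T ∘ χ) (x₀ ∷ xs)
    chosen = subst (All (T ∘ χ)) members≡ (all-filter (T? ∘ χ) G)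
    m∈χ : T (χ m)
    m∈χ = argmax-all (degree χ) (All.head chosen) (All.tail chosen)
    maximal : ∀ y → T (χ y) → degree χ y ≤ degree χ m
    maximal y y∈χ with subst (y ∈_) members≡ (∈-filter⁺ (T? ∘ χ) (G-complete y) y∈χ)
    ... | here refl = f[⊥]≤f[argmax] {f = degree χ} x₀ xs
    ... | there y∈xs = All.lookup (f[xs]≤f[argmax] {f = degree χ} x₀ xs) y∈xs
    three-triples≤ : 3 * triples χ ≤ size χ * degree χ m
    three-triples≤ = begin
      3 * triples χ                       ≡⟨ ∑-degree χ ⟨
      ∑[ y ∈ G ] ⟦ χ y ⟧ * degree χ y     ≤⟨ ∑∈-mono-≤ G pointwise ⟩
      ∑[ y ∈ G ] ⟦ χ y ⟧ * degree χ m     ≡⟨ *-distribʳ-∑∈ G (degree χ m) (λ y → ⟦ χ y ⟧) ⟨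
      size χ * degree χ m                 ∎
      where
      pointwise : ∀ y → ⟦ χ y ⟧ * degree χ y ≤ ⟦ χ y ⟧ * degree χ m
      pointwise y with χ y in χy≡true
      ... | true = *-monoʳ-≤ 1 (maximal y (subst T (sym χy≡true) _))
      ... | false = z≤n

  shrink : ∀ d k χ {N t} → size χ ≡ k + d → triples χ * falling₃ N ≤ t * falling₃ (size χ) →
    ∃[ χ′ ] size χ′ ≡ k × triples χ′ * falling₃ N ≤ t * falling₃ k
  shrink zero k χ {N} {t} size≡k+0 ratio =
    χ , size≡k , subst (λ v → triples χ * falling₃ N ≤ t * falling₃ v) size≡k ratio
    where
    size≡k : size χ ≡ k
    size≡k = trans size≡k+0 (+-identityʳ k)
  shrink (suc d) k χ {N} {t} size≡ ratio with deletion-step χ (subst (1 ≤_) (sym size≡) (≤-trans (s≤s z≤n) (m≤n+m (suc d) k)))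
  ... | χ′ , size≡1+size′ , step = shrink d k χ′ {N} {t} size′≡ (falling-ratio (size χ′) (triples χ) (triples χ′) (falling₃ N) t
          (subst (λ v → v * triples χ′ + 3 * triples χ ≤ v * triples χ) size≡1+size′ step)
          (subst (λ v → triples χ * falling₃ N ≤ t * falling₃ v) size≡1+size′ ratio))
    where
    size′≡ : size χ′ ≡ k + d
    size′≡ = suc-injective (trans (sym size≡1+size′) (trans size≡ (+-suc k d)))

  size≡0⇒triples≡0 : ∀ χ → size χ ≡ 0 → triples χ ≡ 0
  size≡0⇒triples≡0 χ size≡0 = ∑∈-zero G λ {a} _ → ∑∈-zero G λ {b} _ → ∑∈-zero G λ {c} _ →
    cong (λ u → u * (⟦ χ b ⟧ * ⟦ χ c ⟧) * I a b c) (absent a)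
    where
    absent : ∀ a → ⟦ χ a ⟧ ≡ 0
    absent a = n≤0⇒n≡0 (subst (⟦ χ a ⟧ ≤_) size≡0 (term≤∑∈ G (λ a → ⟦ χ a ⟧) (G-complete a)))

  clean : ∀ s χ → size χ ≡ s → ∃[ χ* ] triples χ* ≡ 0 × size χ ≤ size χ* + triples χ
  clean zero χ size≡0 = χ , size≡0⇒triples≡0 χ size≡0 , m≤m+n _ _
  clean (suc s) χ size≡ with triples χ ≟ 0
  ... | yes triples≡0 = χ , triples≡0 , m≤m+n _ _
  ... | no triples≢0 with deletion-step χ (subst (1 ≤_) (sym size≡) (s≤s z≤n))
  ... | χ′ , size≡1+size′ , step with clean s χ′ (suc-injective (trans (sym size≡1+size′) size≡))
  ... | χ* , triples*≡0 , size′≤ = χ* , triples*≡0 , (begin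
    size χ                         ≡⟨ size≡1+size′ ⟩
    suc (size χ′)                  ≤⟨ s≤s size′≤ ⟩
    suc (size χ* + triples χ′)     ≡⟨ +-suc (size χ*) (triples χ′) ⟨
    size χ* + suc (triples χ′)     ≤⟨ +-monoʳ-≤ (size χ*) fewer ⟩
    size χ* + triples χ            ∎)
    where
    open ≤-Reasoning
    fewer : triples χ′ < triples χ
    fewer = *-cancelˡ-< (size χ) (triples χ′) (triples χ) (begin-strict
      size χ * triples χ′                   <⟨ m<m+n _ (≤-trans (n≢0⇒n>0 triples≢0) (m≤n*m _ 3)) ⟩
      size χ * triples χ′ + 3 * triples χ   ≤⟨ step ⟩
      size χ * triples χ                    ∎)

  weight≤triples : ∀ χ a b c → weight χ a b c ≤ triples χ
  weight≤triples χ a b c =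
    ≤-trans (term≤∑∈ G (weight χ a b) (G-complete c))
   (≤-trans (term≤∑∈ G (λ b′ → ∑∈ G (weight χ a b′)) (G-complete b))
            (term≤∑∈ G (λ a′ → ∑[ b′ ∈ G ] ∑∈ G (weight χ a′ b′)) (G-complete a)))

  triples≡0⇒I≡0 : ∀ χ → triples χ ≡ 0 → ∀ {a b c} → a ∈ members χ → b ∈ members χ → c ∈ members χ → I a b c ≡ 0
  triples≡0⇒I≡0 χ triples≡0 {a} {b} {c} a∈ b∈ c∈ = n≤0⇒n≡0 (begin
    I a b c                  ≡⟨ *-identityˡ (I a b c) ⟨
    1 * I a b c              ≡⟨ cong (_* I a b c) mask≡1 ⟨
    weight χ a b c           ≤⟨ weight≤triples χ a b c ⟩
    triples χ                ≡⟨ triples≡0 ⟩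
    0                        ∎)
    where
    open ≤-Reasoning
    member : ∀ {x} → x ∈ members χ → ⟦ χ x ⟧ ≡ 1
    member {x} x∈ = 𝟙-yes (T? (χ x)) (proj₂ (∈-filter⁻ (T? ∘ χ) {xs = G} x∈))
    mask≡1 : mask χ a b c ≡ 1
    mask≡1 = cong₂ _*_ (member a∈) (cong₂ _*_ (member b∈) (member c∈))

-- Choosing the number of points to keep

n≤2^⌈log2⌉ : ∀ n acc → n ≤ 2 ^ ⌈log2⌉ n acc
n≤2^⌈log2⌉ zero _ = z≤n
n≤2^⌈log2⌉ (suc zero) _ = s≤s z≤n
n≤2^⌈log2⌉ (suc (suc m)) (acc rs) = begin
  suc (suc m)                          ≤⟨ s≤s (s≤s (≤-trans (≤-reflexive (sym (⌊n/2⌋+⌈n/2⌉≡n m))) (+-monoˡ-≤ ⌈ m /2⌉ (⌊n/2⌋≤⌈n/2⌉ m)))) ⟩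
  suc (suc (⌈ m /2⌉ + ⌈ m /2⌉))        ≡⟨ cong suc (+-suc ⌈ m /2⌉ ⌈ m /2⌉) ⟨
  suc ⌈ m /2⌉ + suc ⌈ m /2⌉            ≡⟨ cong (suc ⌈ m /2⌉ +_) (+-identityʳ _) ⟨
  2 * suc ⌈ m /2⌉                      ≤⟨ *-monoʳ-≤ 2 (n≤2^⌈log2⌉ (suc ⌈ m /2⌉) _) ⟩
  2 * 2 ^ ⌈log2⌉ (suc ⌈ m /2⌉) _       ∎
  where open ≤-Reasoning

n≤2^⌈log₂n⌉ : ∀ n → n ≤ 2 ^ ⌈log₂ n ⌉
n≤2^⌈log₂n⌉ n = n≤2^⌈log2⌉ n (<-wellFounded n)

equalNorms≤log : ∀ n → 2 ≤ n → equalNorms n ≤ 145 * ⌈log₂ n ⌉ * (n * n)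
equalNorms≤log n 2≤n with ⌈log₂ n ⌉ | ⌈log₂⌉-mono-≤ 2≤n | n≤2^⌈log₂n⌉ n
... | suc L′ | _ | n≤2^L = begin
  equalNorms n                                            ≤⟨ equalNorms≤ n ⟩
  n * n + 2 * energy (3 * n)                              ≤⟨ +-monoʳ-≤ (n * n) (*-monoʳ-≤ 2 (energy≤ (3 * n) (3 + L′) 3n≤2^[3+L′])) ⟩
  n * n + 2 * (2 * (3 * n * ((4 + L′) * (3 * n))))        ≡⟨ expand n L′ ⟩
  145 * (n * n) + 36 * L′ * (n * n)                       ≤⟨ +-monoʳ-≤ (145 * (n * n)) (*-monoˡ-≤ (n * n) (*-monoˡ-≤ L′ (m≤m+n 36 109))) ⟩
  145 * (n * n) + 145 * L′ * (n * n)                      ≡⟨ factor 145 L′ n ⟩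
  145 * suc L′ * (n * n)                                  ∎
  where
  open ≤-Reasoning
  3n≤2^[3+L′] : 3 * n ≤ 2 ^ (3 + L′)
  3n≤2^[3+L′] = ≤-trans (*-monoˡ-≤ n (n≤1+n 3)) (≤-trans (≤-reflexive (*-assoc 2 2 n)) (*-monoʳ-≤ 2 (*-monoʳ-≤ 2 n≤2^L)))
  expand : ∀ n L′ → n * n + 2 * (2 * (3 * n * ((4 + L′) * (3 * n)))) ≡ 145 * (n * n) + 36 * L′ * (n * n)
  expand = solve-∀
  factor : ∀ c L n → c * (n * n) + c * L * (n * n) ≡ c * suc L * (n * n)
  factor = solve-∀

equidistantTriples≤log : ∀ n → 2 ≤ n → equidistantTriples n ≤ 2320 * ⌈log₂ n ⌉ * (n * n * (n * n))
equidistantTriples≤log n 2≤n = begin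
  equidistantTriples n                              ≤⟨ equidistantTriples≤ n ⟩
  n * (n * (16 * equalNorms n))                     ≤⟨ *-monoʳ-≤ n (*-monoʳ-≤ n (*-monoʳ-≤ 16 (equalNorms≤log n 2≤n))) ⟩
  n * (n * (16 * (145 * ⌈log₂ n ⌉ * (n * n))))     ≡⟨ regroup 16 145 n ⌈log₂ n ⌉ ⟩
  2320 * ⌈log₂ n ⌉ * (n * n * (n * n))             ∎
  where
  open ≤-Reasoning
  regroup : ∀ a b n L → n * (n * (a * (b * L * (n * n)))) ≡ a * b * L * (n * n * (n * n))
  regroup = solve-∀

-- 2320 · L · N² bounds the number of equidistant triples (equidistantTriples≤log), and 18560 = 8 · 2320.
few-triples-left : ∀ L N k e t → 4 ≤ N → t ≤ 2320 * L * (N * N) → e * falling₃ N ≤ t * falling₃ k →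
  18560 * L * (k * k) ≤ N → 2 * e ≤ k
few-triples-left L N k e t 4≤N t≤ ratio k-small = *-cancelʳ-≤ (2 * e) k (4 * falling₃ N) {{>-nonZero falling₃N>0}} (begin
  2 * e * (4 * falling₃ N)                         ≡⟨ regroup₁ e (falling₃ N) ⟩
  8 * (e * falling₃ N)                             ≤⟨ *-monoʳ-≤ 8 ratio ⟩
  8 * (t * falling₃ k)                             ≤⟨ *-monoʳ-≤ 8 (*-mono-≤ t≤ (falling₃≤cube k)) ⟩
  8 * (2320 * L * (N * N) * (k * k * k))           ≡⟨ regroup₂ 2320 L N k ⟩
  18560 * L * (k * k) * (N * N * k)                ≤⟨ *-monoˡ-≤ (N * N * k) k-small ⟩
  N * (N * N * k)                                  ≡⟨ regroup₃ N k ⟩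
  N * N * N * k                                    ≤⟨ *-monoˡ-≤ k (cube≤4*falling₃ N 4≤N) ⟩
  4 * falling₃ N * k                               ≡⟨ *-comm (4 * falling₃ N) k ⟩
  k * (4 * falling₃ N)                             ∎)
  where
  open ≤-Reasoning
  falling₃N>0 : 0 < 4 * falling₃ N
  falling₃N>0 = ≤-trans (s≤s z≤n) (≤-trans (*-mono-≤ (*-mono-≤ 4≤N 4≤N) 4≤N) (cube≤4*falling₃ N 4≤N))
  regroup₁ : ∀ e f → 2 * e * (4 * f) ≡ 8 * (e * f)
  regroup₁ = solve-∀
  regroup₂ : ∀ c L N k → 8 * (c * L * (N * N) * (k * k * k)) ≡ 8 * c * L * (k * k) * (N * N * k)
  regroup₂ = solve-∀
  regroup₃ : ∀ N k → N * (N * N * k) ≡ N * N * N * k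
  regroup₃ = solve-∀

last-satisfying : ∀ {ℓ} {P : ℕ → Set ℓ} (P? : ∀ k → Dec (P k)) m → P 0 → ¬ P (suc m) →
  ∃[ k ] k ≤ m × P k × ¬ P (suc k)
last-satisfying P? zero p0 ¬p1 = 0 , z≤n , p0 , ¬p1
last-satisfying P? (suc m) p0 ¬p[2+m] with P? (suc m)
... | yes p[1+m] = suc m , ≤-refl , p[1+m] , ¬p[2+m]
... | no ¬p[1+m] with last-satisfying P? m p0 ¬p[1+m]
... | k , k≤m , pk , ¬p[1+k] = k , m≤n⇒m≤1+n k≤m , pk , ¬p[1+k]

half-survives : ∀ k s e → k ≤ s + e → 2 * e ≤ k → k ≤ 2 * s
half-survives k s e k≤s+e 2e≤k = +-cancelʳ-≤ k k (2 * s) (begin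
  k + k                   ≤⟨ +-mono-≤ k≤s+e k≤s+e ⟩
  (s + e) + (s + e)       ≡⟨ regroup s e ⟩
  2 * s + 2 * e           ≤⟨ +-monoʳ-≤ (2 * s) 2e≤k ⟩
  2 * s + k               ∎)
  where
  open ≤-Reasoning
  regroup : ∀ s e → (s + e) + (s + e) ≡ 2 * s + 2 * e
  regroup = solve-∀

final-bound : ∀ L n k s → n * n < 18560 * L * (suc k * suc k) → suc k ≤ 4 * s → 1 * 1 * (n * n) ≤ 545 * 545 * (s * s) * L
final-bound L n k s n²< 1+k≤4s = begin
  1 * 1 * (n * n)                     ≡⟨ *-identityˡ (n * n) ⟩
  n * n                               ≤⟨ <⇒≤ n²< ⟩
  18560 * L * (suc k * suc k)         ≤⟨ *-monoʳ-≤ (18560 * L) (*-mono-≤ 1+k≤4s 1+k≤4s) ⟩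
  18560 * L * (4 * s * (4 * s))       ≡⟨ regroup 18560 L s ⟩
  296960 * (s * s) * L                ≤⟨ *-monoˡ-≤ L (*-monoˡ-≤ (s * s) (m≤m+n 296960 65)) ⟩
  545 * 545 * (s * s) * L             ∎
  where
  open ≤-Reasoning
  regroup : ∀ c L s → c * L * (4 * s * (4 * s)) ≡ c * 16 * (s * s) * L
  regroup = solve-∀

_≟ₚ_ : ∀ {n} → DecidableEquality (Point n)
_≟ₚ_ = ≡-dec Fin._≟_ Fin._≟_

Isosceles : ∀ {n} → Point n → Point n → Point n → Set
Isosceles a b c = a ≢ b × b ≢ c × a ≢ c × dist² a b ≡ dist² b c

isosceles? : ∀ {n} (a b c : Point n) → Dec (Isosceles a b c)
isosceles? a b c = ¬? (a ≟ₚ b) ×-dec ¬? (b ≟ₚ c) ×-dec ¬? (a ≟ₚ c) ×-dec dist² a b ≟ dist² b c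

isosceles-distinct : ∀ {n} {a b c : Point n} → 𝟙 (isosceles? a b c) ≢ 0 → a ≢ b × b ≢ c × a ≢ c
isosceles-distinct {a = a} {b} {c} 𝟙≢0 with isosceles? a b c
... | yes (a≢b , b≢c , a≢c , _) = a≢b , b≢c , a≢c
... | no _ = contradiction refl 𝟙≢0

module GridDeletion (n : ℕ) = Deletion {Point n} _≟ₚ_ (grid n) grid-unique grid-complete
  (λ a b c → 𝟙 (isosceles? a b c)) isosceles-distinct

module _ (n : ℕ) where
  open GridDeletion n

  isoFreeSet : ∀ χ → triples χ ≡ 0 → IsoFreeSet n
  isoFreeSet χ triples≡0 = record
    { elems = members χ
    ; unique = filter⁺ (T? ∘ χ) grid-unique
    ; isoFree = λ a b c a∈ b∈ c∈ a≢b b≢c a≢c d≡d → contradiction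
        (trans (sym (𝟙-yes (isosceles? a b c) (a≢b , b≢c , a≢c , d≡d))) (triples≡0⇒I≡0 χ triples≡0 a∈ b∈ c∈)) λ ()
    }

  full : Subset
  full _ = true

  size-full : size full ≡ n * n
  size-full = trans (∑-grid n (λ _ → 1) (λ _ _ → 1) (λ _ _ → refl))
                    (trans (∑-cong n λ _ _ → trans (∑-const n 1) (*-identityʳ n)) (∑-const n n))

  triples-full≤ : triples full ≤ equidistantTriples n
  triples-full≤ = ∑∈-mono-≤ (grid n) λ a → ∑∈-mono-≤ (grid n) λ b → ∑∈-mono-≤ (grid n) λ c →
    ≤-trans (≤-reflexive (*-identityˡ _)) (𝟙-mono (isosceles? a b c) (dist² a b ≟ dist² b c) λ (_ , _ , _ , d≡d) → d≡d)

  isoFree-half : 2 ≤ n → ∀ k → k ≤ n → 18560 * ⌈log₂ n ⌉ * (k * k) ≤ n * n →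
    Σ (IsoFreeSet n) λ S → k ≤ 2 * length (IsoFreeSet.elems S)
  isoFree-half 2≤n k k≤n k-small = after-shrinking (shrink (n * n ∸ k) k full {n * n} {triples full}
    (trans size-full (sym (m+[n∸m]≡n k≤n*n))) (≤-reflexive (cong (λ v → triples full * falling₃ v) (sym size-full))))
    where
    k≤n*n : k ≤ n * n
    k≤n*n = ≤-trans k≤n (m≤m*n n n {{>-nonZero (≤-trans (s≤s z≤n) 2≤n)}})
    after-cleaning : ∀ χ₁ → size χ₁ ≡ k → 2 * triples χ₁ ≤ k → (∃[ χ* ] triples χ* ≡ 0 × size χ₁ ≤ size χ* + triples χ₁) →
      Σ (IsoFreeSet n) λ S → k ≤ 2 * length (IsoFreeSet.elems S)
    after-cleaning χ₁ size₁≡k few (χ* , triples*≡0 , size₁≤) = isoFreeSet χ* triples*≡0 ,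
      subst (λ s → k ≤ 2 * s) (sym (length-members≡size χ*)) (half-survives k (size χ*) (triples χ₁) (subst (_≤ size χ* + triples χ₁) size₁≡k size₁≤) few)
    after-shrinking : (∃[ χ₁ ] size χ₁ ≡ k × triples χ₁ * falling₃ (n * n) ≤ triples full * falling₃ k) →
      Σ (IsoFreeSet n) λ S → k ≤ 2 * length (IsoFreeSet.elems S)
    after-shrinking (χ₁ , size₁≡k , ratio) = after-cleaning χ₁ size₁≡k
      (few-triples-left ⌈log₂ n ⌉ (n * n) k (triples χ₁) (triples full) (*-mono-≤ 2≤n 2≤n)
        (≤-trans triples-full≤ (equidistantTriples≤log n 2≤n)) ratio k-small)
      (clean (size χ₁) χ₁ refl)

singleton : ∀ m → IsoFreeSet (suc m)
singleton m = record
  { elems = (Fin.zero , Fin.zero) ∷ []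
  ; unique = [] ∷ []
  ; isoFree = λ { a b c (here refl) (here refl) _ a≢b _ _ _ → a≢b refl }
  }

large-isoFreeSet : ∀ n → 2 ≤ n → Σ (IsoFreeSet n) λ S →
  1 * 1 * (n * n) ≤ 545 * 545 * (length (IsoFreeSet.elems S) * length (IsoFreeSet.elems S)) * ⌈log₂ n ⌉
large-isoFreeSet n@(suc m) 2≤n = choose (last-satisfying (λ k → 18560 * L * (k * k) ≤? n * n) n fits-0 (<⇒≱ n*n<))
  where
  L = ⌈log₂ n ⌉
  18560*L≢0 : NonZero (18560 * L)
  18560*L≢0 = m*n≢0 18560 L {{_}} {{>-nonZero (⌈log₂⌉-mono-≤ 2≤n)}}
  fits-0 : 18560 * L * (0 * 0) ≤ n * n
  fits-0 = ≤-trans (≤-reflexive (*-zeroʳ (18560 * L))) z≤n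
  n*n< : n * n < 18560 * L * (suc n * suc n)
  n*n< = <-≤-trans (*-mono-< (n<1+n n) (n<1+n n)) (m≤n*m _ (18560 * L) {{18560*L≢0}})
  choose : (∃[ k ] k ≤ n × 18560 * L * (k * k) ≤ n * n × ¬ 18560 * L * (suc k * suc k) ≤ n * n) →
    Σ (IsoFreeSet n) λ S → 1 * 1 * (n * n) ≤ 545 * 545 * (length (IsoFreeSet.elems S) * length (IsoFreeSet.elems S)) * L
  choose (zero , _ , _ , too-big) = singleton m , final-bound L n 0 1 (≰⇒> too-big) (s≤s z≤n)
  choose (suc k , 1+k≤n , fits , too-big) =
    let S , 1+k≤2s = isoFree-half n 2≤n (suc k) 1+k≤n fits
        s = length (IsoFreeSet.elems S)
    in S , final-bound L n (suc k) s (≰⇒> too-big)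
             (≤-trans (+-monoˡ-≤ (suc k) (s≤s z≤n)) (≤-trans (+-mono-≤ 1+k≤2s 1+k≤2s) (≤-reflexive (2s+2s≡4s s))))
    where
    2s+2s≡4s : ∀ s → 2 * s + 2 * s ≡ 4 * s
    2s+2s≡4s = solve-∀

mainTheorem5 : Σ ℕ λ p → Σ ℕ λ q → p > 0 × q > 0 ×
    ((n : ℕ) → 2 ≤ n → Σ (IsoFreeSet n) λ S →
      p * p * (n * n) ≤ q * q * (length (IsoFreeSet.elems S) * length (IsoFreeSet.elems S)) * ⌈log₂ n ⌉)
mainTheorem5 = 1 , 545 , s≤s z≤n , s≤s z≤n , large-isoFreeSet
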